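{- Let $n_1,\ldots,n_s$ be distinct positive integers and $r_1,\ldots,r_s$ positive integers, and let $G=K_{r_1.n_1,\ldots,r_s.n_s}$, with $k=\sum_i r_i$ and $n=\sum_i r_in_i$. Put $\sigma_0=1$, $\sigma_i=\sum_{1\leq j_1<\cdots<j_i\leq s} n_{j_1}\cdots n_{j_i}$ for $i=1,\ldots,s$; and for $l=1,\ldots,s$ put $\sigma_{l0}=0$, $\sigma_{l1}=n_l$, and $\sigma_{li}=\sum_{1\leq j_1<\cdots<j_{i-1}\leq s,\ j_1,\ldots,j_{i-1}\neq l} n_ln_{j_1}\cdots n_{j_{i-1}}$ for $i=2,\ldots,s$. Then $$S_G(\lambda)=(\lambda +1)^{n-k} \prod_{i=1}^{s}(\lambda+1-2n_i)^{r_i-1} \Big(\lambda^s+\sum_{m=1}^{s}\sum_{i=0}^{m}(-1)^{i-1}2^{i-1}\tbinom{s-i}{m-i}\Big(\sum_{l=1}^{s}r_l\sigma_{li}-2\sigma_i\Big)\lambda^{s-m}\Big).$$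
   Context: For a simple graph $G$ with adjacency matrix $A(G)$, the Seidel matrix is $S(G)=J-I-2A(G)$, where $I$ is the identity matrix and $J$ the all-ones matrix. The Seidel characteristic polynomial is $S_G(\lambda)=\det(\lambda I-S(G))$. $K_{r_1.n_1,\ldots,r_s.n_s}$ denotes the complete multipartite graph having exactly $r_i$ parts of size $n_i$ for each $i$; two vertices are adjacent iff they lie in different parts. -}

module Defs where

open import Data.Nat as ℕ using (ℕ; zero; suc; _∸_; _≡ᵇ_)
open import Data.Integer using (+_)
open import Data.Bool using (Bool; true; false; not; if_then_else_)
open import Data.Fin using (Fin; zero; suc; punchIn)
open import Data.List using (List; []; _∷_; length; replicate; _++_; concatMap; allFin; lookup; map)
open import Data.Nat.ListAction using (sum; product)
open import Data.Nat.Combinatorics using (_C_)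
open import Relation.Nullary using (yes; no; ¬?)
open import Data.List using (filter)
open import Data.Rational using (ℚ; 0ℚ; 1ℚ; -½; _+_; _*_; _-_; -_; _/_)

ℕtoℚ : ℕ → ℚ
ℕtoℚ m = (+ m) / 1

_^ℚ_ : ℚ → ℕ → ℚ
x ^ℚ zero  = 1ℚ
x ^ℚ suc m = x * (x ^ℚ m)

Σ : ∀ {m} → (Fin m → ℚ) → ℚ
Σ {zero}  f = 0ℚ
Σ {suc m} f = f zero + Σ (λ i → f (suc i))

Π : ∀ {m} → (Fin m → ℚ) → ℚ
Π {zero}  f = 1ℚ
Π {suc m} f = f zero * Π (λ i → f (suc i))

Σℕ : ∀ {m} → (Fin m → ℕ) → ℕ
Σℕ {zero}  f = 0
Σℕ {suc m} f = f zero ℕ.+ Σℕ (λ i → f (suc i))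

Matrix : ℕ → Set
Matrix m = Fin m → Fin m → ℚ

sign : ℕ → ℚ
sign zero          = 1ℚ
sign (suc zero)    = - 1ℚ
sign (suc (suc j)) = sign j

det : ∀ {m} → Matrix m → ℚ
det {zero}  M = 1ℚ
det {suc m} M = Σ (λ j → sign (Data.Fin.toℕ j) * M zero j * det (λ a b → M (suc a) (punchIn j b)))

δ : ∀ {m} → Fin m → Fin m → ℚ
δ i j with i Data.Fin.≟ j
... | yes _ = 1ℚ
... | no  _ = 0ℚ

record Graph (N : ℕ) : Set where
  field
    adj : Fin N → Fin N → Bool

adjMatrix : ∀ {N} → Graph N → Matrix N
adjMatrix G u v = if Graph.adj G u v then 1ℚ else 0ℚ

seidel : ∀ {N} → Graph N → Matrix N
seidel G u v = 1ℚ - δ u v - ℕtoℚ 2 * adjMatrix G u v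

seidelCharPoly : ∀ {N} → Graph N → ℚ → ℚ
seidelCharPoly G x = det (λ u v → x * δ u v - seidel G u v)

partLabels : ℕ → List ℕ → List ℕ
partLabels k []       = []
partLabels k (p ∷ ps) = replicate p k ++ partLabels (suc k) ps

completeMultipartite : (sizes : List ℕ) → Graph (length (partLabels 0 sizes))
completeMultipartite sizes = record
  { adj = λ u v → not (lookup (partLabels 0 sizes) u ≡ᵇ lookup (partLabels 0 sizes) v) }

-- part sizes of K_{r_1.n_1, ..., r_s.n_s}: r_i parts of size n_i for each i
multipartSizes : (s : ℕ) → (Fin s → ℕ) → (Fin s → ℕ) → List ℕ
multipartSizes s r n = concatMap (λ i → replicate (r i) (n i)) (allFin s)

K : (s : ℕ) → (r n : Fin s → ℕ) → Graph (length (partLabels 0 (multipartSizes s r n)))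
K s r n = completeMultipartite (multipartSizes s r n)

choose : {A : Set} → ℕ → List A → List (List A)
choose zero    xs       = [] ∷ []
choose (suc i) []       = []
choose (suc i) (x ∷ xs) = map (x ∷_) (choose i xs) ++ choose (suc i) xs

σ : (s : ℕ) → (Fin s → ℕ) → ℕ → ℕ
σ s n i = sum (map (λ c → product (map n c)) (choose i (allFin s)))

others : (s : ℕ) → Fin s → List (Fin s)
others s l = filter (λ j → ¬? (j Data.Fin.≟ l)) (allFin s)

σl : (s : ℕ) → (Fin s → ℕ) → Fin s → ℕ → ℕ
σl s n l zero          = 0
σl s n l (suc zero)    = n l
σl s n l (suc (suc j)) = sum (map (λ c → n l ℕ.* product (map n c)) (choose (suc j) (others s l)))

-- (-1)^{i-1} 2^{i-1} as a rational number (for i = 0 this is -1/2)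
coef : ℕ → ℚ
coef zero    = -½
coef (suc j) = sign j * (ℕtoℚ 2 ^ℚ j)

theorem2p9RHS : (s : ℕ) → (r n : Fin s → ℕ) → ℚ → ℚ
theorem2p9RHS s r n x =
  ((x + 1ℚ) ^ℚ (nTot ∸ k))
  * Π (λ i → (x + 1ℚ - ℕtoℚ 2 * ℕtoℚ (n i)) ^ℚ (r i ∸ 1))
  * ( (x ^ℚ s)
    + Σ {s} (λ m′ → let m = suc (Data.Fin.toℕ m′) in
        Σ {suc m} (λ i′ → let i = Data.Fin.toℕ i′ in
          coef i * ℕtoℚ ((s ∸ i) C (m ∸ i))
          * (Σ (λ l → ℕtoℚ (r l) * ℕtoℚ (σl s n l i)) - ℕtoℚ 2 * ℕtoℚ (σ s n i))
          * (x ^ℚ (s ∸ m)))))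
  where
    k    = Σℕ r
    nTot = Σℕ (λ i → r i ℕ.* n i)

-- Write y = λ + 1. Labelling each vertex by its part, λ I − S(G) = y I + J − 2 E, where E u v = 1 iff
-- u and v lie in the same part. The determinant of M_c = y I + c J − 2 E is affine in c, and row
-- operations peel off one vertex at a time: a label occurring once gives
-- det M_c(l ∷ T) = (y − 2) det M_c(T) + c det M_0(T), a repeated label gives the recurrence
-- D(p+2) = y (2 D(p+1) − y D(p)). Solving it, a part of size p contributes φ(p) = y^(p−1) (y − 2p)
-- and ψ(p) = p y^(p−1), whence
--   S_G(λ) = y^(n−k) ∏ᵢ wᵢ^(rᵢ−1) (∏ᵢ wᵢ + Σₗ rₗ nₗ ∏_{i≠l} wᵢ),   wᵢ = y − 2nᵢ.
-- Expanding the last factor in powers of y by Vieta's formulas (with the σᵢ and σₗᵢ) and then in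
-- powers of λ by the binomial theorem gives the coefficients of the theorem.

module Submission where

open import Defs
open import Level using (0ℓ)
open import Data.Empty using (⊥-elim)
open import Data.Bool using (Bool; true; false; not; if_then_else_)
open import Data.Bool.Properties using (T-≡)
open import Data.Nat as ℕ using (ℕ; zero; suc; _∸_; _≤_; _<_; _<ᵇ_; _≡ᵇ_; s≤s; z≤n)
import Data.Nat.Properties as ℕₚ
open import Algebra.Properties.CommutativeSemigroup ℕₚ.+-commutativeSemigroup
  using () renaming (interchange to +-interchange)
import Data.Nat.Coprimality as Coprimality
open import Data.Nat.Combinatorics using (_C_; nCk+nC[k+1]≡[n+1]C[k+1]; k>n⇒nCk≡0)
open import Data.Nat.ListAction using (sum; product)
open import Data.Nat.ListAction.Properties using (sum-++)
import Data.Integer as ℤ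
import Data.Integer.Properties as ℤₚ
open import Data.Fin as Fin using (Fin; zero; suc; toℕ; fromℕ<; punchIn; punchOut)
open import Data.Fin.Properties
  using (suc-injective; toℕ-injective; toℕ-fromℕ<; toℕ<n; punchIn-punchOut; punchOut-cong; punchOut-punchIn; punchInᵢ≢i)
open import Data.List using (List; []; _∷_; length; replicate; _++_; concat; map; tabulate; allFin; filter; lookup)
open import Data.List.Properties using (map-tabulate; map-++; map-∘; length-map; length-tabulate)
open import Data.Rational using (ℚ; mkℚ; 0ℚ; 1ℚ; ½; _+_; _*_; _-_; -_; _/_)
open import Data.Rational.Properties
  using (+-*-commutativeRing; _≟_; +-identityˡ; +-identityʳ; +-inverseʳ; +-comm; *-zeroʳ; *-identityˡ; *-distribˡ-+; normalize-coprime)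
open import Function using (_∘_; Equivalence)
open import Function.Definitions using (Injective)
open import Relation.Binary.PropositionalEquality
open import Relation.Nullary using (Dec; yes; no; does; ¬?)
open import Relation.Nullary.Decidable using (dec⇒maybe)
open import Tactic.RingSolver using (solve-∀)
import Tactic.RingSolver.Core.AlmostCommutativeRing as ACR

open ≡-Reasoning

ℚ-ring : ACR.AlmostCommutativeRing 0ℓ 0ℓ
ℚ-ring = ACR.fromCommutativeRing +-*-commutativeRing (λ x → dec⇒maybe (0ℚ ≟ x))

Σ-cong : ∀ {m} {f g : Fin m → ℚ} → (∀ i → f i ≡ g i) → Σ f ≡ Σ g
Σ-cong {zero}  e = refl
Σ-cong {suc m} e = cong₂ _+_ (e zero) (Σ-cong (e ∘ suc))

Σ-zero : ∀ {m} {f : Fin m → ℚ} → (∀ i → f i ≡ 0ℚ) → Σ f ≡ 0ℚ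
Σ-zero {zero}  e = refl
Σ-zero {suc m} e = trans (cong₂ _+_ (e zero) (Σ-zero (e ∘ suc))) (+-identityˡ 0ℚ)

Σ-linear : ∀ {m} {f : Fin m → ℚ} (g h : Fin m → ℚ) (c : ℚ) → (∀ i → f i ≡ g i + c * h i) → Σ f ≡ Σ g + c * Σ h
Σ-linear {zero}  g h c e = sym (trans (cong (0ℚ +_) (*-zeroʳ c)) (+-identityˡ 0ℚ))
Σ-linear {suc m} {f} g h c e = begin
  f zero + Σ (f ∘ suc)                              ≡⟨ cong₂ _+_ (e zero) (Σ-linear (g ∘ suc) (h ∘ suc) c (e ∘ suc)) ⟩
  (g zero + c * h zero) + (Σ (g ∘ suc) + c * Σ (h ∘ suc)) ≡⟨ regroup (g zero) (h zero) (Σ (g ∘ suc)) (Σ (h ∘ suc)) c ⟩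
  (g zero + Σ (g ∘ suc)) + c * (h zero + Σ (h ∘ suc)) ∎
  where
  regroup : ∀ a b u v c → (a + c * b) + (u + c * v) ≡ (a + u) + c * (b + v)
  regroup = solve-∀ ℚ-ring

Σ-distrib-+ : ∀ {m} (f g : Fin m → ℚ) → Σ (λ i → f i + g i) ≡ Σ f + Σ g
Σ-distrib-+ f g = trans (Σ-linear f g 1ℚ (λ i → cong (f i +_) (sym (*-identityˡ (g i)))))
                        (cong (Σ f +_) (*-identityˡ (Σ g)))

*-distribˡ-Σ : ∀ {m} (c : ℚ) (f : Fin m → ℚ) → c * Σ f ≡ Σ (λ i → c * f i)
*-distribˡ-Σ {zero}  c f = *-zeroʳ c
*-distribˡ-Σ {suc m} c f = trans (*-distribˡ-+ c (f zero) _) (cong (c * f zero +_) (*-distribˡ-Σ c (f ∘ suc)))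

-‿distrib-Σ : ∀ {m} (f : Fin m → ℚ) → - Σ f ≡ Σ (λ i → - f i)
-‿distrib-Σ f = trans (neg-as-scaling (Σ f)) (trans (*-distribˡ-Σ (- 1ℚ) f) (Σ-cong (sym ∘ neg-as-scaling ∘ f)))
  where
  neg-as-scaling : ∀ x → - x ≡ - 1ℚ * x
  neg-as-scaling = solve-∀ ℚ-ring

Σ-remove : ∀ {m} (k : Fin (suc m)) (f : Fin (suc m) → ℚ) → Σ f ≡ f k + Σ (f ∘ punchIn k)
Σ-remove zero    f = refl
Σ-remove {suc m} (suc k) f = begin
  f zero + Σ (f ∘ suc)                                    ≡⟨ cong (f zero +_) (Σ-remove k (f ∘ suc)) ⟩
  f zero + (f (suc k) + Σ (f ∘ suc ∘ punchIn k))          ≡⟨ left-comm (f zero) (f (suc k)) _ ⟩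
  f (suc k) + (f zero + Σ (f ∘ suc ∘ punchIn k))          ∎
  where
  left-comm : ∀ a b c → a + (b + c) ≡ b + (a + c)
  left-comm = solve-∀ ℚ-ring

Σ-comm : ∀ {m n} (H : Fin m → Fin n → ℚ) → Σ (λ k → Σ (H k)) ≡ Σ (λ l → Σ (λ k → H k l))
Σ-comm {zero} {n} H = sym (Σ-zero {n} {λ _ → 0ℚ} (λ _ → refl))
Σ-comm {suc m} H = trans (cong (Σ (H zero) +_) (Σ-comm (H ∘ suc))) (sym (Σ-distrib-+ (H zero) _))

δ-refl : ∀ {m} (i : Fin m) → δ i i ≡ 1ℚ
δ-refl i with i Fin.≟ i
... | yes _   = refl
... | no i≢i = ⊥-elim (i≢i refl)

δ-≢ : ∀ {m} {i j : Fin m} → i ≢ j → δ i j ≡ 0ℚ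
δ-≢ {i = i} {j} i≢j with i Fin.≟ j
... | yes i≡j = ⊥-elim (i≢j i≡j)
... | no  _   = refl

det-cong : ∀ {m} {A B : Matrix m} → (∀ a b → A a b ≡ B a b) → det A ≡ det B
det-cong {zero}  e = refl
det-cong {suc m} e = Σ-cong (λ j → cong₂ _*_ (cong (sign (toℕ j) *_) (e zero j))
                                              (det-cong (λ a b → e (suc a) (punchIn j b))))

minor : ∀ {m} → Matrix (suc m) → Fin (suc m) → Matrix m
minor A j a b = A (suc a) (punchIn j b)

laplaceTerm : ∀ {m} → Matrix (suc m) → Fin (suc m) → ℚ
laplaceTerm A j = sign (toℕ j) * A zero j * det (minor A j)

laplaceTerm-entry-zero : ∀ {m} (A : Matrix (suc m)) j → A zero j ≡ 0ℚ → laplaceTerm A j ≡ 0ℚ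
laplaceTerm-entry-zero A j e = trans (cong (λ u → sign (toℕ j) * u * det (minor A j)) e) (zero-middle (sign (toℕ j)) _)
  where
  zero-middle : ∀ s d → s * 0ℚ * d ≡ 0ℚ
  zero-middle = solve-∀ ℚ-ring

laplaceTerm-minor-zero : ∀ {m} (A : Matrix (suc m)) j → det (minor A j) ≡ 0ℚ → laplaceTerm A j ≡ 0ℚ
laplaceTerm-minor-zero A j e = trans (cong (sign (toℕ j) * A zero j *_) e) (*-zeroʳ (sign (toℕ j) * A zero j))

det-linear-row : ∀ {m} (i : Fin m) (A A₁ A₂ : Matrix m) (c : ℚ)
  → (∀ a → a ≢ i → ∀ b → A₁ a b ≡ A a b)
  → (∀ a → a ≢ i → ∀ b → A₂ a b ≡ A a b)
  → (∀ b → A i b ≡ A₁ i b + c * A₂ i b)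
  → det A ≡ det A₁ + c * det A₂
det-linear-row {suc m} zero A A₁ A₂ c agree₁ agree₂ row-i = Σ-linear (laplaceTerm A₁) (laplaceTerm A₂) c λ j →
  let s = sign (toℕ j)
      minor≡₁ = det-cong (λ a b → sym (agree₁ (suc a) (λ ()) (punchIn j b)))
      minor₁≡₂ = det-cong (λ a b → trans (agree₁ (suc a) (λ ()) (punchIn j b)) (sym (agree₂ (suc a) (λ ()) (punchIn j b))))
  in begin
  s * A zero j * det (minor A j)                            ≡⟨ cong₂ (λ u d → s * u * d) (row-i j) minor≡₁ ⟩
  s * (A₁ zero j + c * A₂ zero j) * det (minor A₁ j)        ≡⟨ distrib s (A₁ zero j) (A₂ zero j) (det (minor A₁ j)) c ⟩
  laplaceTerm A₁ j + c * (s * A₂ zero j * det (minor A₁ j)) ≡⟨ cong (λ d → laplaceTerm A₁ j + c * (s * A₂ zero j * d)) minor₁≡₂ ⟩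
  laplaceTerm A₁ j + c * laplaceTerm A₂ j                   ∎
  where
  distrib : ∀ s u v d c → s * (u + c * v) * d ≡ s * u * d + c * (s * v * d)
  distrib = solve-∀ ℚ-ring
det-linear-row {suc m} (suc i) A A₁ A₂ c agree₁ agree₂ row-i = Σ-linear (laplaceTerm A₁) (laplaceTerm A₂) c λ j →
  let s = sign (toℕ j)
      minor-linear = det-linear-row i (minor A j) (minor A₁ j) (minor A₂ j) c
                       (λ a a≢i b → agree₁ (suc a) (a≢i ∘ suc-injective) (punchIn j b))
                       (λ a a≢i b → agree₂ (suc a) (a≢i ∘ suc-injective) (punchIn j b))
                       (λ b → row-i (punchIn j b))
  in begin
  s * A zero j * det (minor A j)                              ≡⟨ cong₂ (λ u d → s * u * d) (sym (agree₁ zero (λ ()) j)) minor-linear ⟩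
  s * A₁ zero j * (det (minor A₁ j) + c * det (minor A₂ j))   ≡⟨ distrib s (A₁ zero j) _ _ c ⟩
  laplaceTerm A₁ j + c * (s * A₁ zero j * det (minor A₂ j))   ≡⟨ cong (λ u → laplaceTerm A₁ j + c * (s * u * det (minor A₂ j)))
                                                                   (trans (agree₁ zero (λ ()) j) (sym (agree₂ zero (λ ()) j))) ⟩
  laplaceTerm A₁ j + c * laplaceTerm A₂ j                     ∎
  where
  distrib : ∀ s u d e c → s * u * (d + c * e) ≡ s * u * d + c * (s * u * e)
  distrib = solve-∀ ℚ-ring

det-additive-row : ∀ {m} (i : Fin m) (A A₁ A₂ : Matrix m)
  → (∀ a → a ≢ i → ∀ b → A₁ a b ≡ A a b)
  → (∀ a → a ≢ i → ∀ b → A₂ a b ≡ A a b)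
  → (∀ b → A i b ≡ A₁ i b + A₂ i b)
  → det A ≡ det A₁ + det A₂
det-additive-row i A A₁ A₂ agree₁ agree₂ row-i =
  trans (det-linear-row i A A₁ A₂ 1ℚ agree₁ agree₂ (λ b → trans (row-i b) (cong (A₁ i b +_) (sym (*-identityˡ (A₂ i b))))))
        (cong (det A₁ +_) (*-identityˡ (det A₂)))

sign-suc : ∀ t → sign (suc t) ≡ - sign t
sign-suc zero    = refl
sign-suc (suc t) = trans (neg-involutive (sign t)) (cong -_ (sym (sign-suc t)))
  where
  neg-involutive : ∀ x → x ≡ - - x
  neg-involutive = solve-∀ ℚ-ring

punchIn-punchOut-swap : ∀ {n} {k l : Fin (suc (suc n))} (k≢l : k ≢ l) (l≢k : l ≢ k) b →
  punchIn k (punchIn (punchOut k≢l) b) ≡ punchIn l (punchIn (punchOut l≢k) b)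
punchIn-punchOut-swap {_}     {zero}  {zero}  k≢l _ _ = ⊥-elim (k≢l refl)
punchIn-punchOut-swap {_}     {zero}  {suc l} _   _ _ = refl
punchIn-punchOut-swap {_}     {suc k} {zero}  _   _ _ = refl
punchIn-punchOut-swap {zero}  {suc zero} {suc zero} k≢l _ _ = ⊥-elim (k≢l refl)
punchIn-punchOut-swap {suc n} {suc k} {suc l} _ _ zero = refl
punchIn-punchOut-swap {suc n} {suc k} {suc l} k≢l l≢k (suc b) =
  cong suc (punchIn-punchOut-swap (k≢l ∘ cong suc) (l≢k ∘ cong suc) b)

sign-punchOut-swap : ∀ {n} {k l : Fin (suc (suc n))} (k≢l : k ≢ l) (l≢k : l ≢ k) →
  sign (toℕ k) * sign (toℕ (punchOut k≢l)) ≡ - (sign (toℕ l) * sign (toℕ (punchOut l≢k)))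
sign-punchOut-swap {_}     {zero}  {zero}  k≢l _ = ⊥-elim (k≢l refl)
sign-punchOut-swap {_}     {zero}  {suc l} _   _ = trans (shift (sign (toℕ l))) (cong (λ s → - (s * 1ℚ)) (sym (sign-suc (toℕ l))))
  where
  shift : ∀ s → 1ℚ * s ≡ - (- s * 1ℚ)
  shift = solve-∀ ℚ-ring
sign-punchOut-swap {_}     {suc k} {zero}  _   _ = trans (cong (_* 1ℚ) (sign-suc (toℕ k))) (shift (sign (toℕ k)))
  where
  shift : ∀ s → - s * 1ℚ ≡ - (1ℚ * s)
  shift = solve-∀ ℚ-ring
sign-punchOut-swap {zero}  {suc zero} {suc zero} k≢l _ = ⊥-elim (k≢l refl)
sign-punchOut-swap {suc n} {suc k} {suc l} k≢l l≢k = begin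
  sign (suc (toℕ k)) * sign (suc (toℕ k′))          ≡⟨ cong₂ _*_ (sign-suc (toℕ k)) (sign-suc (toℕ k′)) ⟩
  - sign (toℕ k) * - sign (toℕ k′)                  ≡⟨ neg-*-neg (sign (toℕ k)) _ ⟩
  sign (toℕ k) * sign (toℕ k′)                      ≡⟨ sign-punchOut-swap (k≢l ∘ cong suc) (l≢k ∘ cong suc) ⟩
  - (sign (toℕ l) * sign (toℕ l′))                  ≡⟨ cong -_ (sym (neg-*-neg (sign (toℕ l)) _)) ⟩
  - (- sign (toℕ l) * - sign (toℕ l′))              ≡⟨ cong -_ (sym (cong₂ _*_ (sign-suc (toℕ l)) (sign-suc (toℕ l′)))) ⟩
  - (sign (suc (toℕ l)) * sign (suc (toℕ l′)))      ∎
  where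
  k′ l′ : Fin (suc n)
  k′ = punchOut (k≢l ∘ cong suc)
  l′ = punchOut (l≢k ∘ cong suc)
  neg-*-neg : ∀ a b → - a * - b ≡ a * b
  neg-*-neg = solve-∀ ℚ-ring

x≡-x⇒x≡0 : ∀ {x : ℚ} → x ≡ - x → x ≡ 0ℚ
x≡-x⇒x≡0 {x} e = begin
  x            ≡⟨ halve x ⟩
  ½ * (x + x)  ≡⟨ cong (λ y → ½ * (x + y)) e ⟩
  ½ * (x - x)  ≡⟨ cong (½ *_) (+-inverseʳ x) ⟩
  ½ * 0ℚ       ≡⟨ *-zeroʳ ½ ⟩
  0ℚ           ∎
  where
  halve : ∀ x → x ≡ ½ * (x + x)
  halve = solve-∀ ℚ-ring

-- Expanding twice along the first two rows writes det A as a double sum Σₖ Σₗ H k l, where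
-- H vanishes on the diagonal and, as rows 0 and 1 coincide, is antisymmetric.
det-rows01-equal : ∀ {m} (A : Matrix (suc (suc m))) → (∀ b → A zero b ≡ A (suc zero) b) → det A ≡ 0ℚ
det-rows01-equal {m} A rows01 = trans expand (x≡-x⇒x≡0 antisym)
  where
  N : ℕ
  N = suc (suc m)
  v : Fin N → ℚ
  v = A zero

  D : Fin N → Fin (suc m) → Matrix m
  D k l a b = A (suc (suc a)) (punchIn k (punchIn l b))

  T : Fin N → Fin (suc m) → ℚ
  T k l = (sign (toℕ k) * v k) * ((sign (toℕ l) * v (punchIn k l)) * det (D k l))

  H : Fin N → Fin N → ℚ
  H k l with k Fin.≟ l
  ... | yes _   = 0ℚ
  ... | no k≢l = T k (punchOut k≢l)

  H-diagonal : ∀ k → H k k ≡ 0ℚ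
  H-diagonal k with k Fin.≟ k
  ... | yes _   = refl
  ... | no k≢k = ⊥-elim (k≢k refl)

  H-punchIn : ∀ k l → H k (punchIn k l) ≡ T k l
  H-punchIn k l with k Fin.≟ punchIn k l
  ... | yes e   = ⊥-elim (punchInᵢ≢i k l (sym e))
  ... | no k≢kl = cong (T k) (trans (punchOut-cong k refl) (punchOut-punchIn k))

  ΣH≡ΣT : ∀ k → Σ (H k) ≡ Σ (T k)
  ΣH≡ΣT k = trans (Σ-remove k (H k)) (trans (cong₂ _+_ (H-diagonal k) (Σ-cong (H-punchIn k))) (+-identityˡ _))

  T-swap : ∀ {k l} (k≢l : k ≢ l) (l≢k : l ≢ k) → T k (punchOut k≢l) ≡ - T l (punchOut l≢k)
  T-swap {k} {l} k≢l l≢k = begin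
    (sk * v k) * ((sk′ * v (punchIn k k′)) * det (D k k′)) ≡⟨ cong (λ c → (sk * v k) * ((sk′ * v c) * det (D k k′))) (punchIn-punchOut k≢l) ⟩
    (sk * v k) * ((sk′ * v l) * det (D k k′))              ≡⟨ gather sk sk′ (v k) (v l) _ ⟩
    (sk * sk′) * (v k * v l * det (D k k′))                ≡⟨ cong₂ (λ s d → s * (v k * v l * d)) (sign-punchOut-swap k≢l l≢k)
                                                                (det-cong (λ a b → cong (A (suc (suc a))) (punchIn-punchOut-swap k≢l l≢k b))) ⟩
    - (sl * sl′) * (v k * v l * det (D l l′))              ≡⟨ scatter sl sl′ (v k) (v l) _ ⟩
    - ((sl * v l) * ((sl′ * v k) * det (D l l′)))          ≡⟨ cong (λ c → - ((sl * v l) * ((sl′ * v c) * det (D l l′)))) (sym (punchIn-punchOut l≢k)) ⟩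
    - ((sl * v l) * ((sl′ * v (punchIn l l′)) * det (D l l′))) ∎
    where
    k′ l′ : Fin (suc m)
    k′ = punchOut k≢l
    l′ = punchOut l≢k
    sk sk′ sl sl′ : ℚ
    sk = sign (toℕ k)
    sk′ = sign (toℕ k′)
    sl = sign (toℕ l)
    sl′ = sign (toℕ l′)
    gather : ∀ a b x y d → (a * x) * ((b * y) * d) ≡ (a * b) * (x * y * d)
    gather = solve-∀ ℚ-ring
    scatter : ∀ a b x y d → - (a * b) * (x * y * d) ≡ - ((a * y) * ((b * x) * d))
    scatter = solve-∀ ℚ-ring

  H-antisym : ∀ k l → H k l ≡ - H l k
  H-antisym k l with k Fin.≟ l | l Fin.≟ k
  ... | yes _   | yes _   = refl
  ... | yes k≡l | no l≢k = ⊥-elim (l≢k (sym k≡l))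
  ... | no k≢l | yes l≡k = ⊥-elim (k≢l (sym l≡k))
  ... | no k≢l | no l≢k = T-swap k≢l l≢k

  X : ℚ
  X = Σ (λ k → Σ (H k))

  expand : det A ≡ X
  expand = Σ-cong λ k → begin
    sign (toℕ k) * v k * det (minor A k)
      ≡⟨ cong (sign (toℕ k) * v k *_) (Σ-cong (λ l → cong (λ u → sign (toℕ l) * u * det (D k l)) (sym (rows01 (punchIn k l))))) ⟩
    sign (toℕ k) * v k * Σ (λ l → sign (toℕ l) * v (punchIn k l) * det (D k l))
      ≡⟨ *-distribˡ-Σ (sign (toℕ k) * v k) (λ l → sign (toℕ l) * v (punchIn k l) * det (D k l)) ⟩
    Σ (T k)
      ≡⟨ ΣH≡ΣT k ⟨
    Σ (H k) ∎

  antisym : X ≡ - X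
  antisym = begin
    Σ (λ k → Σ (λ l → H k l))     ≡⟨ Σ-cong (λ k → Σ-cong (H-antisym k)) ⟩
    Σ (λ k → Σ (λ l → - H l k))   ≡⟨ Σ-cong (λ k → -‿distrib-Σ (λ l → H l k)) ⟨
    Σ (λ k → - Σ (λ l → H l k))   ≡⟨ -‿distrib-Σ (λ k → Σ (λ l → H l k)) ⟨
    - Σ (λ k → Σ (λ l → H l k))   ≡⟨ cong -_ (Σ-comm H) ⟨
    - X                            ∎

det-swap-rows01 : ∀ {m} (A B : Matrix (suc (suc m)))
  → (∀ b → B zero b ≡ A (suc zero) b) → (∀ b → B (suc zero) b ≡ A zero b)
  → (∀ a b → B (suc (suc a)) b ≡ A (suc (suc a)) b) → det B ≡ - det A
det-swap-rows01 {m} A B e0 e1 e2 = begin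
  det B           ≡⟨ det-cong {A = B} {B = R w u} (λ { zero b → e0 b ; (suc zero) b → e1 b ; (suc (suc a)) b → e2 a b }) ⟩
  det (R w u)     ≡⟨ +≡0⇒≡- cancel ⟩
  - det (R u w)   ≡⟨ cong -_ (det-cong {A = R u w} {B = A} (λ { zero b → refl ; (suc zero) b → refl ; (suc (suc a)) b → refl })) ⟩
  - det A         ∎
  where
  N : ℕ
  N = suc (suc m)
  u w : Fin N → ℚ
  u = A zero
  w = A (suc zero)

  R : (p q : Fin N → ℚ) → Matrix N
  R p q zero          = p
  R p q (suc zero)    = q
  R p q (suc (suc a)) = A (suc (suc a))

  s : Fin N → ℚ
  s b = u b + w b

  split0 : ∀ q → det (R s q) ≡ det (R u q) + det (R w q)
  split0 q = det-additive-row zero (R s q) (R u q) (R w q) rest rest (λ b → refl)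
    where
    rest : ∀ {p} a → a ≢ zero → ∀ b → R p q a b ≡ R s q a b
    rest zero          0≢0 _ = ⊥-elim (0≢0 refl)
    rest (suc zero)    _   _ = refl
    rest (suc (suc a)) _   _ = refl

  split1 : ∀ p → det (R p s) ≡ det (R p u) + det (R p w)
  split1 p = det-additive-row (suc zero) (R p s) (R p u) (R p w) rest rest (λ b → refl)
    where
    rest : ∀ {q} a → a ≢ suc zero → ∀ b → R p q a b ≡ R p s a b
    rest zero          _   _ = refl
    rest (suc zero)    1≢1 _ = ⊥-elim (1≢1 refl)
    rest (suc (suc a)) _   _ = refl

  repeated : ∀ p → det (R p p) ≡ 0ℚ
  repeated p = det-rows01-equal (R p p) (λ b → refl)

  cancel : det (R u w) + det (R w u) ≡ 0ℚ
  cancel = begin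
    det (R u w) + det (R w u)                                 ≡⟨ pad (det (R u w)) (det (R w u)) ⟩
    (0ℚ + det (R u w)) + (det (R w u) + 0ℚ)                   ≡⟨ cong₂ (λ a b → (a + det (R u w)) + (det (R w u) + b))
                                                                   (sym (repeated u)) (sym (repeated w)) ⟩
    (det (R u u) + det (R u w)) + (det (R w u) + det (R w w)) ≡⟨ cong₂ _+_ (split1 u) (split1 w) ⟨
    det (R u s) + det (R w s)                                 ≡⟨ split0 s ⟨
    det (R s s)                                               ≡⟨ repeated s ⟩
    0ℚ                                                        ∎
    where
    pad : ∀ a b → a + b ≡ (0ℚ + a) + (b + 0ℚ)
    pad = solve-∀ ℚ-ring

  +≡0⇒≡- : ∀ {a b} → a + b ≡ 0ℚ → b ≡ - a
  +≡0⇒≡- {a} {b} e = trans (isolate a b) (trans (cong (_- a) e) (+-identityˡ (- a)))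
    where
    isolate : ∀ a b → b ≡ (a + b) - a
    isolate = solve-∀ ℚ-ring

mutual
  det-equal-rows : ∀ {m} (A : Matrix m) {i j : Fin m} → i ≢ j → (∀ b → A i b ≡ A j b) → det A ≡ 0ℚ
  det-equal-rows A {zero}  {zero}  0≢0 _ = ⊥-elim (0≢0 refl)
  det-equal-rows A {zero}  {suc j} _   e = det-row0-repeated A j e
  det-equal-rows A {suc i} {zero}  _   e = det-row0-repeated A i (sym ∘ e)
  det-equal-rows {suc m} A {suc i} {suc j} i≢j e =
    Σ-zero λ k → laplaceTerm-minor-zero A k (det-equal-rows (minor A k) (i≢j ∘ cong suc) (e ∘ punchIn k))

  det-row0-repeated : ∀ {m} (A : Matrix (suc m)) (j : Fin m) → (∀ b → A zero b ≡ A (suc j) b) → det A ≡ 0ℚ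
  det-row0-repeated {suc m}       A zero    e = det-rows01-equal A e
  det-row0-repeated {suc (suc m)} A (suc j) e = begin
    det A        ≡⟨ det-swap-rows01 A′ A (λ _ → refl) (λ _ → refl) (λ _ _ → refl) ⟩
    - det A′     ≡⟨ cong -_ (Σ-zero λ k → laplaceTerm-minor-zero A′ k
                      (det-equal-rows (minor A′ k) {zero} {suc j} (λ ()) (e ∘ punchIn k))) ⟩
    - 0ℚ         ∎
    where
    A′ : Matrix (suc (suc (suc m)))
    A′ zero          = A (suc zero)
    A′ (suc zero)    = A zero
    A′ (suc (suc a)) = A (suc (suc a))

det-add-multiple-of-row : ∀ {m} (A B : Matrix m) {i j : Fin m} (c : ℚ) → i ≢ j
  → (∀ a → a ≢ i → ∀ b → A a b ≡ B a b) → (∀ b → A i b ≡ B i b + c * B j b) → det A ≡ det B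
det-add-multiple-of-row {m} A B {i} {j} c i≢j same added = begin
  det A               ≡⟨ det-linear-row i A B R c (λ a a≢i b → sym (same a a≢i b))
                           (λ a a≢i b → trans (R-other a a≢i b) (sym (same a a≢i b)))
                           (λ b → trans (added b) (cong (λ x → B i b + c * x) (sym (R-row-i b)))) ⟩
  det B + c * det R    ≡⟨ cong (λ d → det B + c * d)
                           (det-equal-rows R i≢j (λ b → trans (R-row-i b) (sym (R-other j (i≢j ∘ sym) b)))) ⟩
  det B + c * 0ℚ      ≡⟨ cong (det B +_) (*-zeroʳ c) ⟩
  det B + 0ℚ          ≡⟨ +-identityʳ (det B) ⟩
  det B               ∎
  where
  R : Matrix m
  R a with a Fin.≟ i
  ... | yes _ = B j
  ... | no  _ = B a

  R-row-i : ∀ b → R i b ≡ B j b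
  R-row-i b with i Fin.≟ i
  ... | yes _   = refl
  ... | no i≢i = ⊥-elim (i≢i refl)

  R-other : ∀ a → a ≢ i → ∀ b → R a b ≡ B a b
  R-other a a≢i b with a Fin.≟ i
  ... | yes a≡i = ⊥-elim (a≢i a≡i)
  ... | no  _   = refl

<ᵇ-irrefl : ∀ n → (n <ᵇ n) ≡ false
<ᵇ-irrefl zero    = refl
<ᵇ-irrefl (suc n) = <ᵇ-irrefl n

<⇒<ᵇ≡true : ∀ {m n} → m < n → (m <ᵇ n) ≡ true
<⇒<ᵇ≡true m<n = Equivalence.to T-≡ (ℕₚ.<⇒<ᵇ m<n)

<ᵇ-suc-≢ : ∀ m n → m ≢ n → (m <ᵇ suc n) ≡ (m <ᵇ n)
<ᵇ-suc-≢ zero    zero    m≢n = ⊥-elim (m≢n refl)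
<ᵇ-suc-≢ zero    (suc n) _   = refl
<ᵇ-suc-≢ (suc m) zero    _   = refl
<ᵇ-suc-≢ (suc m) (suc n) m≢n = <ᵇ-suc-≢ m n (m≢n ∘ cong suc)

det-add-multiples-of-row0 : ∀ {m} (A B : Matrix (suc m)) (t : Fin m → ℚ)
  → (∀ b → B zero b ≡ A zero b) → (∀ a b → B (suc a) b ≡ A (suc a) b + t a * A zero b) → det B ≡ det A
det-add-multiples-of-row0 {m} A B t row0 rows = trans (det-cong {A = B} {B = partial m} B≡partial-m) (partial≡A m ℕₚ.≤-refl)
  where
  partial : ℕ → Matrix (suc m)
  partial k zero    b = A zero b
  partial k (suc a) b = if toℕ a <ᵇ k then A (suc a) b + t a * A zero b else A (suc a) b

  step : ∀ k (k<m : k < m) → det (partial (suc k)) ≡ det (partial k)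
  step k k<m = det-add-multiple-of-row (partial (suc k)) (partial k) {suc a} {zero} (t a) (λ ()) untouched added
    where
    a = fromℕ< k<m
    untouched : ∀ a′ → a′ ≢ suc a → ∀ b → partial (suc k) a′ b ≡ partial k a′ b
    untouched zero     _ b = refl
    untouched (suc a′) a′≢a b
      rewrite <ᵇ-suc-≢ (toℕ a′) k (λ e → a′≢a (cong suc (toℕ-injective (trans e (sym (toℕ-fromℕ< k<m)))))) = refl
    added : ∀ b → partial (suc k) (suc a) b ≡ partial k (suc a) b + t a * partial k zero b
    added b rewrite toℕ-fromℕ< k<m | <⇒<ᵇ≡true (ℕₚ.n<1+n k) | <ᵇ-irrefl k = refl

  partial≡A : ∀ k → k ≤ m → det (partial k) ≡ det A
  partial≡A zero    _      = det-cong {A = partial zero} {B = A} (λ { zero b → refl ; (suc a) b → refl })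
  partial≡A (suc k) 1+k≤m = trans (step k 1+k≤m) (partial≡A k (ℕₚ.≤-trans (ℕₚ.n≤1+n k) 1+k≤m))

  B≡partial-m : ∀ a b → B a b ≡ partial m a b
  B≡partial-m zero    b = row0 b
  B≡partial-m (suc a) b rewrite <⇒<ᵇ≡true (toℕ<n a) = rows a b

det-column0-zero : ∀ {m} (A : Matrix (suc m)) → (∀ a → A a zero ≡ 0ℚ) → det A ≡ 0ℚ
det-column0-zero {m} A column0 = Σ-zero (vanish m A column0)
  where
  vanish : ∀ m (A : Matrix (suc m)) → (∀ a → A a zero ≡ 0ℚ) → ∀ j → laplaceTerm A j ≡ 0ℚ
  vanish m       A column0 zero    = laplaceTerm-entry-zero A zero (column0 zero)
  vanish (suc m) A column0 (suc j) = laplaceTerm-minor-zero A (suc j) (det-column0-zero (minor A (suc j)) (column0 ∘ suc))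

det-column0-below-zero : ∀ {m} (A : Matrix (suc m)) → (∀ a → A (suc a) zero ≡ 0ℚ) → det A ≡ A zero zero * det (minor A zero)
det-column0-below-zero {m} A below = begin
  laplaceTerm A zero + Σ (laplaceTerm A ∘ suc) ≡⟨ cong (laplaceTerm A zero +_) (Σ-zero (rest m A below)) ⟩
  laplaceTerm A zero + 0ℚ                      ≡⟨ unit (A zero zero) (det (minor A zero)) ⟩
  A zero zero * det (minor A zero)             ∎
  where
  rest : ∀ m (A : Matrix (suc m)) → (∀ a → A (suc a) zero ≡ 0ℚ) → ∀ j → laplaceTerm A (suc j) ≡ 0ℚ
  rest (suc m) A below j = laplaceTerm-minor-zero A (suc j) (det-column0-zero (minor A (suc j)) below)
  unit : ∀ a d → 1ℚ * a * d + 0ℚ ≡ a * d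
  unit = solve-∀ ℚ-ring

det-row0-scaled-unit : ∀ {m} (A : Matrix (suc m)) (s : ℚ) → (∀ b → A zero b ≡ s * δ zero b) → det A ≡ s * det (minor A zero)
det-row0-scaled-unit {m} A s row0 = begin
  laplaceTerm A zero + Σ (laplaceTerm A ∘ suc) ≡⟨ cong₂ _+_ head (Σ-zero rest) ⟩
  s * det (minor A zero) + 0ℚ                   ≡⟨ +-identityʳ _ ⟩
  s * det (minor A zero)                        ∎
  where
  head : laplaceTerm A zero ≡ s * det (minor A zero)
  head = trans (cong (λ u → 1ℚ * u * det (minor A zero)) (row0 zero)) (unit s _)
    where
    unit : ∀ s d → 1ℚ * (s * 1ℚ) * d ≡ s * d
    unit = solve-∀ ℚ-ring
  rest : ∀ j → laplaceTerm A (suc j) ≡ 0ℚ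
  rest j = laplaceTerm-entry-zero A (suc j) (trans (row0 (suc j)) (*-zeroʳ s))

ℕtoℚ≡mkℚ : ∀ m → ℕtoℚ m ≡ mkℚ (ℤ.+ m) 0 (Coprimality.sym (Coprimality.1-coprimeTo m))
ℕtoℚ≡mkℚ m = normalize-coprime (Coprimality.sym (Coprimality.1-coprimeTo m))

ℕtoℚ-+ : ∀ m n → ℕtoℚ (m ℕ.+ n) ≡ ℕtoℚ m + ℕtoℚ n
ℕtoℚ-+ m n = sym (begin
  ℕtoℚ m + ℕtoℚ n                                ≡⟨ cong₂ _+_ (ℕtoℚ≡mkℚ m) (ℕtoℚ≡mkℚ n) ⟩
  (ℤ.+ m ℤ.* ℤ.+ 1 ℤ.+ ℤ.+ n ℤ.* ℤ.+ 1) / 1      ≡⟨ cong (_/ 1) (cong₂ ℤ._+_ (ℤₚ.*-identityʳ (ℤ.+ m)) (ℤₚ.*-identityʳ (ℤ.+ n))) ⟩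
  (ℤ.+ m ℤ.+ ℤ.+ n) / 1                          ≡⟨ cong (_/ 1) (ℤₚ.pos-+ m n) ⟨
  ℕtoℚ (m ℕ.+ n)                                 ∎)

ℕtoℚ-* : ∀ m n → ℕtoℚ (m ℕ.* n) ≡ ℕtoℚ m * ℕtoℚ n
ℕtoℚ-* m n = sym (trans (cong₂ _*_ (ℕtoℚ≡mkℚ m) (ℕtoℚ≡mkℚ n)) (cong (_/ 1) (sym (ℤₚ.pos-* m n))))

ℕtoℚ-suc : ∀ m → ℕtoℚ (suc m) ≡ ℕtoℚ m + 1ℚ
ℕtoℚ-suc m = trans (cong ℕtoℚ (ℕₚ.+-comm 1 m)) (ℕtoℚ-+ m 1)

^ℚ-distribˡ-+-* : ∀ a m n → a ^ℚ (m ℕ.+ n) ≡ a ^ℚ m * a ^ℚ n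
^ℚ-distribˡ-+-* a zero    n = sym (*-identityˡ _)
^ℚ-distribˡ-+-* a (suc m) n = trans (cong (a *_) (^ℚ-distribˡ-+-* a m n)) (assoc a (a ^ℚ m) (a ^ℚ n))
  where
  assoc : ∀ a b c → a * (b * c) ≡ a * b * c
  assoc = solve-∀ ℚ-ring

^ℚ-distribʳ-* : ∀ a b m → (a * b) ^ℚ m ≡ a ^ℚ m * b ^ℚ m
^ℚ-distribʳ-* a b zero    = refl
^ℚ-distribʳ-* a b (suc m) = trans (cong ((a * b) *_) (^ℚ-distribʳ-* a b m)) (swap a b (a ^ℚ m) (b ^ℚ m))
  where
  swap : ∀ a b c d → a * b * (c * d) ≡ a * c * (b * d)
  swap = solve-∀ ℚ-ring

^ℚ-*-assoc : ∀ a m k → (a ^ℚ m) ^ℚ k ≡ a ^ℚ (m ℕ.* k)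
^ℚ-*-assoc a zero    zero    = refl
^ℚ-*-assoc a zero    (suc k) = trans (cong (1ℚ *_) (^ℚ-*-assoc a zero k)) (*-identityˡ _)
^ℚ-*-assoc a (suc m) k = begin
  (a * a ^ℚ m) ^ℚ k        ≡⟨ ^ℚ-distribʳ-* a (a ^ℚ m) k ⟩
  a ^ℚ k * (a ^ℚ m) ^ℚ k   ≡⟨ cong (a ^ℚ k *_) (^ℚ-*-assoc a m k) ⟩
  a ^ℚ k * a ^ℚ (m ℕ.* k)  ≡⟨ ^ℚ-distribˡ-+-* a k (m ℕ.* k) ⟨
  a ^ℚ (k ℕ.+ m ℕ.* k)     ∎

Π-cong : ∀ {m} {f g : Fin m → ℚ} → (∀ i → f i ≡ g i) → Π f ≡ Π g
Π-cong {zero}  e = refl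
Π-cong {suc m} e = cong₂ _*_ (e zero) (Π-cong (e ∘ suc))

Π-distrib-* : ∀ {m} (f g : Fin m → ℚ) → Π (λ i → f i * g i) ≡ Π f * Π g
Π-distrib-* {zero}  f g = refl
Π-distrib-* {suc m} f g = trans (cong ((f zero * g zero) *_) (Π-distrib-* (f ∘ suc) (g ∘ suc)))
                                (swap (f zero) (g zero) (Π (f ∘ suc)) (Π (g ∘ suc)))
  where
  swap : ∀ a b c d → a * b * (c * d) ≡ a * c * (b * d)
  swap = solve-∀ ℚ-ring

Π-^ℚ : ∀ {m} a (e : Fin m → ℕ) → Π (λ i → a ^ℚ e i) ≡ a ^ℚ Σℕ e
Π-^ℚ {zero}  a e = refl
Π-^ℚ {suc m} a e = trans (cong (a ^ℚ e zero *_) (Π-^ℚ a (e ∘ suc))) (sym (^ℚ-distribˡ-+-* a (e zero) _))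

Π-except : ∀ {s} → Fin s → (Fin s → ℚ) → ℚ
Π-except {suc s} l f = Π (f ∘ punchIn l)

Π-remove : ∀ {s} (l : Fin s) (f : Fin s → ℚ) → Π f ≡ f l * Π-except l f
Π-remove {suc s}       zero    f = refl
Π-remove {suc (suc s)} (suc l) f = begin
  f zero * Π (f ∘ suc)                                ≡⟨ cong (f zero *_) (Π-remove l (f ∘ suc)) ⟩
  f zero * (f (suc l) * Π-except l (f ∘ suc))         ≡⟨ left-comm (f zero) (f (suc l)) _ ⟩
  f (suc l) * (f zero * Π-except l (f ∘ suc))         ∎
  where
  left-comm : ∀ a b c → a * (b * c) ≡ b * (a * c)
  left-comm = solve-∀ ℚ-ring

Π-except-cong : ∀ {s} (l : Fin s) {f g : Fin s → ℚ} → (∀ i → f i ≡ g i) → Π-except l f ≡ Π-except l g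
Π-except-cong {suc s} l e = Π-cong (e ∘ punchIn l)

Π-except-distrib-* : ∀ {s} (l : Fin s) (f g : Fin s → ℚ) → Π-except l (λ i → f i * g i) ≡ Π-except l f * Π-except l g
Π-except-distrib-* {suc s} l f g = Π-distrib-* (f ∘ punchIn l) (g ∘ punchIn l)

Σℕ-cong : ∀ {s} {f g : Fin s → ℕ} → (∀ i → f i ≡ g i) → Σℕ f ≡ Σℕ g
Σℕ-cong {zero}  e = refl
Σℕ-cong {suc s} e = cong₂ ℕ._+_ (e zero) (Σℕ-cong (e ∘ suc))

Σℕ-distrib-+ : ∀ {s} (f g : Fin s → ℕ) → Σℕ (λ i → f i ℕ.+ g i) ≡ Σℕ f ℕ.+ Σℕ g
Σℕ-distrib-+ {zero}  f g = refl
Σℕ-distrib-+ {suc s} f g = trans (cong ((f zero ℕ.+ g zero) ℕ.+_) (Σℕ-distrib-+ (f ∘ suc) (g ∘ suc)))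
                                 (+-interchange (f zero) (g zero) _ _)

multipartSizes-suc : ∀ s (r n : Fin (suc s) → ℕ) →
  multipartSizes (suc s) r n ≡ replicate (r zero) (n zero) ++ multipartSizes s (r ∘ suc) (n ∘ suc)
multipartSizes-suc s r n = cong (λ parts → replicate (r zero) (n zero) ++ concat parts)
  (trans (map-tabulate suc (λ i → replicate (r i) (n i))) (sym (map-tabulate (λ i → i) (λ i → replicate (r (suc i)) (n (suc i))))))

vertexCount∸partCount : ∀ {s} (r n : Fin s → ℕ) → (∀ i → 1 ≤ n i) →
  Σℕ (λ i → r i ℕ.* n i) ∸ Σℕ r ≡ Σℕ (λ i → r i ℕ.* (n i ∸ 1))
vertexCount∸partCount r n n≥1 = begin
  Σℕ (λ i → r i ℕ.* n i) ∸ Σℕ r                        ≡⟨ cong (_∸ Σℕ r) (trans (Σℕ-cong split) (Σℕ-distrib-+ _ r)) ⟩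
  Σℕ (λ i → r i ℕ.* (n i ∸ 1)) ℕ.+ Σℕ r ∸ Σℕ r         ≡⟨ ℕₚ.m+n∸n≡m _ (Σℕ r) ⟩
  Σℕ (λ i → r i ℕ.* (n i ∸ 1))                         ∎
  where
  split : ∀ i → r i ℕ.* n i ≡ r i ℕ.* (n i ∸ 1) ℕ.+ r i
  split i with n i | n≥1 i
  ... | suc m | _ = trans (ℕₚ.*-suc (r i) m) (ℕₚ.+-comm (r i) _)

δ-suc : ∀ {m} (i j : Fin m) → δ (suc i) (suc j) ≡ δ i j
δ-suc i j = by-cases (i Fin.≟ j)
  where
  by-cases : Dec (i ≡ j) → δ (suc i) (suc j) ≡ δ i j
  by-cases (yes refl) = trans (δ-refl (suc i)) (sym (δ-refl i))
  by-cases (no  i≢j)  = trans (δ-≢ (i≢j ∘ suc-injective)) (sym (δ-≢ i≢j))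

sameLabel : ℕ → ℕ → ℚ
sameLabel p q = if p ≡ᵇ q then 1ℚ else 0ℚ

sameLabel-refl : ∀ p → sameLabel p p ≡ 1ℚ
sameLabel-refl p rewrite Equivalence.to T-≡ (ℕₚ.≡⇒≡ᵇ p p refl) = refl

sameLabel-≢ : ∀ {p q} → p ≢ q → sameLabel p q ≡ 0ℚ
sameLabel-≢ {p} {q} p≢q with p ≡ᵇ q | ℕₚ.≡ᵇ⇒≡ p q
... | true  | p≡q = ⊥-elim (p≢q (p≡q _))
... | false | _   = refl

module LabelMatrix (y : ℚ) where

  M : ℚ → (L : List ℕ) → Matrix (length L)
  M c L u v = y * δ u v + c - ℕtoℚ 2 * sameLabel (lookup L u) (lookup L v)

  M-suc : ∀ c l T a b → M c (l ∷ T) (suc a) (suc b) ≡ M c T a b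
  M-suc c l T a b = cong (λ d → y * d + c - ℕtoℚ 2 * sameLabel (lookup T a) (lookup T b)) (δ-suc a b)

  M-sameLabel : ∀ c L u v {s} → sameLabel (lookup L u) (lookup L v) ≡ s → M c L u v ≡ y * δ u v + c - ℕtoℚ 2 * s
  M-sameLabel c L u v same≡s = cong (λ s → y * δ u v + c - ℕtoℚ 2 * s) same≡s

  det-fresh-label : ∀ c l T → (∀ u → lookup T u ≢ l)
    → det (M c (l ∷ T)) ≡ (y - ℕtoℚ 2) * det (M c T) + c * det (M 0ℚ T)
  det-fresh-label c l T fresh = begin
    det (M c (l ∷ T))   ≡⟨ det-linear-row zero (M c (l ∷ T)) E Y c
                             (λ { zero 0≢0 → ⊥-elim (0≢0 refl) ; (suc a) _ b → refl })
                             (λ { zero 0≢0 → ⊥-elim (0≢0 refl) ; (suc a) _ b → refl }) row0 ⟩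
    det E + c * det Y   ≡⟨ cong₂ (λ d e → d + c * e) detE detY ⟩
    (y - ℕtoℚ 2) * det (M c T) + c * det (M 0ℚ T) ∎
    where
    n : ℕ
    n = length T
    E Y Z : Matrix (suc n)
    E zero    b = (y - ℕtoℚ 2) * δ zero b
    E (suc a) b = M c (l ∷ T) (suc a) b
    Y zero    b = 1ℚ
    Y (suc a) b = M c (l ∷ T) (suc a) b
    Z zero    b = 1ℚ
    Z (suc a) b = M c (l ∷ T) (suc a) b + - c * 1ℚ

    row0 : ∀ b → M c (l ∷ T) zero b ≡ E zero b + c * Y zero b
    row0 zero    = trans (M-sameLabel c (l ∷ T) zero zero (sameLabel-refl l)) (split y c)
      where
      split : ∀ y c → y * 1ℚ + c - ℕtoℚ 2 * 1ℚ ≡ (y - ℕtoℚ 2) * 1ℚ + c * 1ℚ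
      split = solve-∀ ℚ-ring
    row0 (suc b) = begin
      M c (l ∷ T) zero (suc b)             ≡⟨ M-sameLabel c (l ∷ T) zero (suc b) (sameLabel-≢ (fresh b ∘ sym)) ⟩
      y * 0ℚ + c - ℕtoℚ 2 * 0ℚ             ≡⟨ split y c ⟩
      E zero (suc b) + c * Y zero (suc b)  ∎
      where
      split : ∀ y c → y * 0ℚ + c - ℕtoℚ 2 * 0ℚ ≡ (y - ℕtoℚ 2) * 0ℚ + c * 1ℚ
      split = solve-∀ ℚ-ring

    detE : det E ≡ (y - ℕtoℚ 2) * det (M c T)
    detE = trans (det-row0-scaled-unit E (y - ℕtoℚ 2) (λ _ → refl)) (cong ((y - ℕtoℚ 2) *_) (det-cong (M-suc c l T)))

    -- subtracting c times the all-ones row 0 clears column 0 below it, as the label l is fresh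
    detY : det Y ≡ det (M 0ℚ T)
    detY = begin
      det Y                    ≡⟨ det-add-multiples-of-row0 Y Z (λ _ → - c) (λ _ → refl) (λ _ _ → refl) ⟨
      det Z                    ≡⟨ det-column0-below-zero Z column0 ⟩
      1ℚ * det (minor Z zero)  ≡⟨ *-identityˡ _ ⟩
      det (minor Z zero)       ≡⟨ det-cong (λ a b → trans (cong (_+ - c * 1ℚ) (M-suc c l T a b)) (drop-c y (δ a b) c (sameLabel (lookup T a) (lookup T b)))) ⟩
      det (M 0ℚ T)             ∎
      where
      drop-c : ∀ y d c s → y * d + c - ℕtoℚ 2 * s + - c * 1ℚ ≡ y * d + 0ℚ - ℕtoℚ 2 * s
      drop-c = solve-∀ ℚ-ring
      column0 : ∀ a → Z (suc a) zero ≡ 0ℚ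
      column0 a = trans (cong (_+ - c * 1ℚ) (M-sameLabel c (l ∷ T) (suc a) zero (sameLabel-≢ (fresh a))))
                        (vanish y c)
        where
        vanish : ∀ y c → y * 0ℚ + c - ℕtoℚ 2 * 0ℚ + - c * 1ℚ ≡ 0ℚ
        vanish = solve-∀ ℚ-ring

  det-repeated-label : ∀ c l T → det (M c (l ∷ l ∷ T)) ≡ y * (ℕtoℚ 2 * det (M c (l ∷ T)) - y * det (M c T))
  det-repeated-label c l T = begin
    det A                                  ≡⟨ det-add-multiple-of-row A N {zero} {suc zero} 1ℚ (λ ())
                                                (λ { zero 0≢0 → ⊥-elim (0≢0 refl) ; (suc a) _ _ → refl }) row0 ⟩
    det N                                  ≡⟨ expand ⟩
    y * det P + y * det P′                 ≡⟨ cong (λ d → y * det P + y * d) detP′ ⟩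
    y * det P + y * (det P - y * det (M c T)) ≡⟨ collect y (det P) (det (M c T)) ⟩
    y * (ℕtoℚ 2 * det P - y * det (M c T)) ∎
    where
    n : ℕ
    n = length T
    A : Matrix (suc (suc n))
    A = M c (l ∷ l ∷ T)
    P : Matrix (suc n)
    P = M c (l ∷ T)

    -- row 0 minus row 1 of A: rows 0 and 1 carry the same label, so only their diagonal parts differ
    N : Matrix (suc (suc n))
    N zero    b = y * (δ zero b - δ (suc zero) b)
    N (suc a) b = A (suc a) b

    P′ : Matrix (suc n)
    P′ = minor N (suc zero)

    collect : ∀ y p t → y * p + y * (p - y * t) ≡ y * (ℕtoℚ 2 * p - y * t)
    collect = solve-∀ ℚ-ring

    row0 : ∀ b → A zero b ≡ N zero b + 1ℚ * N (suc zero) b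
    row0 b = split y (δ zero b) (δ (suc zero) b) c (sameLabel l (lookup (l ∷ l ∷ T) b))
      where
      split : ∀ y d₀ d₁ c s → y * d₀ + c - ℕtoℚ 2 * s ≡ y * (d₀ - d₁) + 1ℚ * (y * d₁ + c - ℕtoℚ 2 * s)
      split = solve-∀ ℚ-ring

    expand : det N ≡ y * det P + y * det P′
    expand = begin
      laplaceTerm N zero + (laplaceTerm N (suc zero) + Σ (λ i → laplaceTerm N (suc (suc i))))
        ≡⟨ cong₂ (λ d r → 1ℚ * (y * (1ℚ - 0ℚ)) * d + (- 1ℚ * (y * (0ℚ - 1ℚ)) * det P′ + r))
                 (det-cong (M-suc c l (l ∷ T))) (Σ-zero {f = λ i → laplaceTerm N (suc (suc i))} rest) ⟩
      1ℚ * (y * (1ℚ - 0ℚ)) * det P + (- 1ℚ * (y * (0ℚ - 1ℚ)) * det P′ + 0ℚ)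
        ≡⟨ simplify y (det P) (det P′) ⟩
      y * det P + y * det P′ ∎
      where
      simplify : ∀ y p q → 1ℚ * (y * (1ℚ - 0ℚ)) * p + (- 1ℚ * (y * (0ℚ - 1ℚ)) * q + 0ℚ) ≡ y * p + y * q
      simplify = solve-∀ ℚ-ring
      rest : ∀ i → laplaceTerm N (suc (suc i)) ≡ 0ℚ
      rest i = laplaceTerm-entry-zero N (suc (suc i)) (vanish y)
        where
        vanish : ∀ y → y * (0ℚ - 0ℚ) ≡ 0ℚ
        vanish = solve-∀ ℚ-ring

    E : Matrix (suc n)
    E zero    b = y * δ zero b
    E (suc a) b = P (suc a) b

    P′-below : ∀ a b → P′ (suc a) b ≡ P (suc a) b
    P′-below a zero    = refl
    P′-below a (suc b) = M-suc c l (l ∷ T) (suc a) (suc b)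

    P-row0 : ∀ b → P zero b ≡ P′ zero b + E zero b
    P-row0 zero    = split y c (sameLabel l l)
      where
      split : ∀ y c s → y * 1ℚ + c - ℕtoℚ 2 * s ≡ (y * 0ℚ + c - ℕtoℚ 2 * s) + y * 1ℚ
      split = solve-∀ ℚ-ring
    P-row0 (suc b) = split y c (sameLabel l (lookup T b))
      where
      split : ∀ y c s → y * 0ℚ + c - ℕtoℚ 2 * s ≡ (y * 0ℚ + c - ℕtoℚ 2 * s) + y * 0ℚ
      split = solve-∀ ℚ-ring

    detP′ : det P′ ≡ det P - y * det (M c T)
    detP′ = begin
      det P′                      ≡⟨ isolate (det P′) (det E) ⟩
      (det P′ + det E) - det E    ≡⟨ cong₂ (λ p e → p - e)
                                       (sym (det-additive-row zero P P′ E
                                          (λ { zero 0≢0 → ⊥-elim (0≢0 refl) ; (suc a) _ b → P′-below a b })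
                                          (λ { zero 0≢0 → ⊥-elim (0≢0 refl) ; (suc a) _ b → refl }) P-row0))
                                       (trans (det-row0-scaled-unit E y (λ _ → refl)) (cong (y *_) (det-cong (M-suc c l T)))) ⟩
      det P - y * det (M c T)     ∎
      where
      isolate : ∀ p e → p ≡ (p + e) - e
      isolate = solve-∀ ℚ-ring

  φ ψ : ℕ → ℚ
  φ zero          = 1ℚ
  φ (suc zero)    = y - ℕtoℚ 2
  φ (suc (suc p)) = y * (ℕtoℚ 2 * φ (suc p) - y * φ p)
  ψ zero          = 0ℚ
  ψ (suc zero)    = 1ℚ
  ψ (suc (suc p)) = y * (ℕtoℚ 2 * ψ (suc p) - y * ψ p)

  Φ Ψ : List ℕ → ℚ
  Φ []       = 1ℚ
  Φ (p ∷ ps) = φ p * Φ ps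
  Ψ []       = 0ℚ
  Ψ (p ∷ ps) = φ p * Ψ ps + ψ p * Φ ps

  -- Stated for every c because a fresh label relates the determinant at c to the one at 0.
  det-block : ∀ k R a b → (∀ u → lookup R u ≢ k) → (∀ c → det (M c R) ≡ a + c * b)
    → ∀ p c → det (M c (replicate p k ++ R)) ≡ φ p * (a + c * b) + c * (ψ p * a)
  det-block k R a b fresh detR zero c = trans (detR c) (unit a b c)
    where
    unit : ∀ a b c → a + c * b ≡ 1ℚ * (a + c * b) + c * (0ℚ * a)
    unit = solve-∀ ℚ-ring
  det-block k R a b fresh detR (suc zero) c = begin
    det (M c (k ∷ R))                                ≡⟨ det-fresh-label c k R fresh ⟩
    (y - ℕtoℚ 2) * det (M c R) + c * det (M 0ℚ R)    ≡⟨ cong₂ (λ d e → (y - ℕtoℚ 2) * d + c * e) (detR c) (detR 0ℚ) ⟩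
    (y - ℕtoℚ 2) * (a + c * b) + c * (a + 0ℚ * b)    ≡⟨ tidy y a b c ⟩
    (y - ℕtoℚ 2) * (a + c * b) + c * (1ℚ * a)        ∎
    where
    tidy : ∀ y a b c → (y - ℕtoℚ 2) * (a + c * b) + c * (a + 0ℚ * b) ≡ (y - ℕtoℚ 2) * (a + c * b) + c * (1ℚ * a)
    tidy = solve-∀ ℚ-ring
  det-block k R a b fresh detR (suc (suc p)) c = begin
    det (M c (k ∷ k ∷ replicate p k ++ R))
      ≡⟨ det-repeated-label c k (replicate p k ++ R) ⟩
    y * (ℕtoℚ 2 * det (M c (k ∷ replicate p k ++ R)) - y * det (M c (replicate p k ++ R)))
      ≡⟨ cong₂ (λ d e → y * (ℕtoℚ 2 * d - y * e)) (det-block k R a b fresh detR (suc p) c) (det-block k R a b fresh detR p c) ⟩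
    y * (ℕtoℚ 2 * (φ (suc p) * (a + c * b) + c * (ψ (suc p) * a)) - y * (φ p * (a + c * b) + c * (ψ p * a)))
      ≡⟨ regroup y a b c (φ (suc p)) (φ p) (ψ (suc p)) (ψ p) ⟩
    φ (suc (suc p)) * (a + c * b) + c * (ψ (suc (suc p)) * a) ∎
    where
    regroup : ∀ y a b c f₁ f₀ g₁ g₀ →
      y * (ℕtoℚ 2 * (f₁ * (a + c * b) + c * (g₁ * a)) - y * (f₀ * (a + c * b) + c * (g₀ * a)))
      ≡ y * (ℕtoℚ 2 * f₁ - y * f₀) * (a + c * b) + c * (y * (ℕtoℚ 2 * g₁ - y * g₀) * a)
    regroup = solve-∀ ℚ-ring

  partLabels-≥ : ∀ k ps u → k ≤ lookup (partLabels k ps) u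
  partLabels-≥ k (p ∷ ps) = replicate-++-≥ p
    where
    replicate-++-≥ : ∀ p u → k ≤ lookup (replicate p k ++ partLabels (suc k) ps) u
    replicate-++-≥ zero    u       = ℕₚ.≤-trans (ℕₚ.n≤1+n k) (partLabels-≥ (suc k) ps u)
    replicate-++-≥ (suc p) zero    = ℕₚ.≤-refl
    replicate-++-≥ (suc p) (suc u) = replicate-++-≥ p u

  det-partLabels : ∀ k ps c → det (M c (partLabels k ps)) ≡ Φ ps + c * Ψ ps
  det-partLabels k []       c = unit c
    where
    unit : ∀ c → 1ℚ ≡ 1ℚ + c * 0ℚ
    unit = solve-∀ ℚ-ring
  det-partLabels k (p ∷ ps) c = begin
    det (M c (replicate p k ++ partLabels (suc k) ps))
      ≡⟨ det-block k (partLabels (suc k) ps) (Φ ps) (Ψ ps) fresh (det-partLabels (suc k) ps) p c ⟩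
    φ p * (Φ ps + c * Ψ ps) + c * (ψ p * Φ ps)
      ≡⟨ regroup (φ p) (ψ p) (Φ ps) (Ψ ps) c ⟩
    φ p * Φ ps + c * (φ p * Ψ ps + ψ p * Φ ps) ∎
    where
    fresh : ∀ u → lookup (partLabels (suc k) ps) u ≢ k
    fresh u e = ℕₚ.<-irrefl (sym e) (partLabels-≥ (suc k) ps u)
    regroup : ∀ f g a b c → f * (a + c * b) + c * (g * a) ≡ f * a + c * (f * b + g * a)
    regroup = solve-∀ ℚ-ring

  w : ℕ → ℚ
  w q = y - ℕtoℚ 2 * ℕtoℚ q

  w-suc : ∀ q → w (suc q) ≡ w q - ℕtoℚ 2
  w-suc q = trans (cong (λ m → y - ℕtoℚ 2 * m) (ℕtoℚ-suc q)) (step y (ℕtoℚ q))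
    where
    step : ∀ y q → y - ℕtoℚ 2 * (q + 1ℚ) ≡ (y - ℕtoℚ 2 * q) - ℕtoℚ 2
    step = solve-∀ ℚ-ring

  φ-closed : ∀ p → φ (suc p) ≡ y ^ℚ p * w (suc p)
  φ-closed zero          = base y
    where
    base : ∀ y → y - ℕtoℚ 2 ≡ 1ℚ * (y - ℕtoℚ 2 * ℕtoℚ 1)
    base = solve-∀ ℚ-ring
  φ-closed (suc zero)    = base y
    where
    base : ∀ y → y * (ℕtoℚ 2 * (y - ℕtoℚ 2) - y * 1ℚ) ≡ y * 1ℚ * (y - ℕtoℚ 2 * ℕtoℚ 2)
    base = solve-∀ ℚ-ring
  φ-closed (suc (suc p)) = begin
    y * (ℕtoℚ 2 * φ (suc (suc p)) - y * φ (suc p))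
      ≡⟨ cong₂ (λ a b → y * (ℕtoℚ 2 * a - y * b)) (φ-closed (suc p)) (φ-closed p) ⟩
    y * (ℕtoℚ 2 * (y * y ^ℚ p * w (suc (suc p))) - y * (y ^ℚ p * w (suc p)))
      ≡⟨ cong (λ a → y * (ℕtoℚ 2 * (y * y ^ℚ p * a) - y * (y ^ℚ p * w (suc p)))) (w-suc (suc p)) ⟩
    y * (ℕtoℚ 2 * (y * y ^ℚ p * (w (suc p) - ℕtoℚ 2)) - y * (y ^ℚ p * w (suc p)))
      ≡⟨ step y (y ^ℚ p) (w (suc p)) ⟩
    y * (y * y ^ℚ p) * ((w (suc p) - ℕtoℚ 2) - ℕtoℚ 2)
      ≡⟨ cong (λ a → y * (y * y ^ℚ p) * (a - ℕtoℚ 2)) (w-suc (suc p)) ⟨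
    y * (y * y ^ℚ p) * (w (suc (suc p)) - ℕtoℚ 2)
      ≡⟨ cong (y * (y * y ^ℚ p) *_) (w-suc (suc (suc p))) ⟨
    y * (y * y ^ℚ p) * w (suc (suc (suc p))) ∎
    where
    step : ∀ y Y a → y * (ℕtoℚ 2 * (y * Y * (a - ℕtoℚ 2)) - y * (Y * a)) ≡ y * (y * Y) * ((a - ℕtoℚ 2) - ℕtoℚ 2)
    step = solve-∀ ℚ-ring

  ψ-closed : ∀ p → ψ (suc p) ≡ ℕtoℚ (suc p) * y ^ℚ p
  ψ-closed zero          = refl
  ψ-closed (suc zero)    = base y
    where
    base : ∀ y → y * (ℕtoℚ 2 * 1ℚ - y * 0ℚ) ≡ ℕtoℚ 2 * (y * 1ℚ)
    base = solve-∀ ℚ-ring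
  ψ-closed (suc (suc p)) = begin
    y * (ℕtoℚ 2 * ψ (suc (suc p)) - y * ψ (suc p))
      ≡⟨ cong₂ (λ a b → y * (ℕtoℚ 2 * a - y * b)) (ψ-closed (suc p)) (ψ-closed p) ⟩
    y * (ℕtoℚ 2 * (ℕtoℚ (suc (suc p)) * (y * y ^ℚ p)) - y * (ℕtoℚ (suc p) * y ^ℚ p))
      ≡⟨ cong (λ a → y * (ℕtoℚ 2 * (a * (y * y ^ℚ p)) - y * (ℕtoℚ (suc p) * y ^ℚ p))) (ℕtoℚ-suc (suc p)) ⟩
    y * (ℕtoℚ 2 * ((ℕtoℚ (suc p) + 1ℚ) * (y * y ^ℚ p)) - y * (ℕtoℚ (suc p) * y ^ℚ p))
      ≡⟨ step y (y ^ℚ p) (ℕtoℚ (suc p)) ⟩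
    (ℕtoℚ (suc p) + 1ℚ + 1ℚ) * (y * (y * y ^ℚ p))
      ≡⟨ cong (λ a → (a + 1ℚ) * (y * (y * y ^ℚ p))) (ℕtoℚ-suc (suc p)) ⟨
    (ℕtoℚ (suc (suc p)) + 1ℚ) * (y * (y * y ^ℚ p))
      ≡⟨ cong (_* (y * (y * y ^ℚ p))) (ℕtoℚ-suc (suc (suc p))) ⟨
    ℕtoℚ (suc (suc (suc p))) * (y * (y * y ^ℚ p)) ∎
    where
    step : ∀ y Y q → y * (ℕtoℚ 2 * ((q + 1ℚ) * (y * Y)) - y * (q * Y)) ≡ (q + 1ℚ + 1ℚ) * (y * (y * Y))
    step = solve-∀ ℚ-ring

  groupΦ groupΨ : ℕ → ℕ → ℚ
  groupΦ r n = φ n ^ℚ r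
  groupΨ r n = ℕtoℚ r * ψ n * φ n ^ℚ (r ∸ 1)

  groupFactor : ℕ → ℕ → ℚ
  groupFactor r n = y ^ℚ (r ℕ.* (n ∸ 1)) * w n ^ℚ (r ∸ 1)

  groupΦ≡groupFactor*w : ∀ r n → 1 ≤ r → 1 ≤ n → groupΦ r n ≡ groupFactor r n * w n
  groupΦ≡groupFactor*w (suc r) (suc n) _ _ = begin
    φ (suc n) ^ℚ suc r                                         ≡⟨ cong (_^ℚ suc r) (φ-closed n) ⟩
    (y ^ℚ n * w (suc n)) ^ℚ suc r                              ≡⟨ ^ℚ-distribʳ-* (y ^ℚ n) (w (suc n)) (suc r) ⟩
    (y ^ℚ n) ^ℚ suc r * (w (suc n) * w (suc n) ^ℚ r)           ≡⟨ cong (λ e → e * (w (suc n) * w (suc n) ^ℚ r))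
                                                                     (trans (^ℚ-*-assoc y n (suc r)) (cong (y ^ℚ_) (ℕₚ.*-comm n (suc r)))) ⟩
    y ^ℚ (suc r ℕ.* n) * (w (suc n) * w (suc n) ^ℚ r)          ≡⟨ shuffle (y ^ℚ (suc r ℕ.* n)) (w (suc n)) (w (suc n) ^ℚ r) ⟩
    y ^ℚ (suc r ℕ.* n) * w (suc n) ^ℚ r * w (suc n)            ∎
    where
    shuffle : ∀ a b c → a * (b * c) ≡ a * c * b
    shuffle = solve-∀ ℚ-ring

  groupΨ≡rn*groupFactor : ∀ r n → 1 ≤ r → 1 ≤ n → groupΨ r n ≡ ℕtoℚ r * ℕtoℚ n * groupFactor r n
  groupΨ≡rn*groupFactor (suc r) (suc n) _ _ = begin
    ℕtoℚ (suc r) * ψ (suc n) * φ (suc n) ^ℚ r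
      ≡⟨ cong₂ (λ a b → ℕtoℚ (suc r) * a * b) (ψ-closed n)
           (trans (cong (_^ℚ r) (φ-closed n)) (trans (^ℚ-distribʳ-* (y ^ℚ n) (w (suc n)) r) (cong (_* w (suc n) ^ℚ r) (^ℚ-*-assoc y n r)))) ⟩
    ℕtoℚ (suc r) * (ℕtoℚ (suc n) * y ^ℚ n) * (y ^ℚ (n ℕ.* r) * w (suc n) ^ℚ r)
      ≡⟨ shuffle (ℕtoℚ (suc r)) (ℕtoℚ (suc n)) (y ^ℚ n) (y ^ℚ (n ℕ.* r)) (w (suc n) ^ℚ r) ⟩
    ℕtoℚ (suc r) * ℕtoℚ (suc n) * ((y ^ℚ n * y ^ℚ (n ℕ.* r)) * w (suc n) ^ℚ r)
      ≡⟨ cong (λ e → ℕtoℚ (suc r) * ℕtoℚ (suc n) * (e * w (suc n) ^ℚ r))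
           (trans (sym (^ℚ-distribˡ-+-* y n (n ℕ.* r))) (cong (λ e → y ^ℚ (n ℕ.+ e)) (ℕₚ.*-comm n r))) ⟩
    ℕtoℚ (suc r) * ℕtoℚ (suc n) * groupFactor (suc r) (suc n) ∎
    where
    shuffle : ∀ R N a b c → R * (N * a) * (b * c) ≡ R * N * ((a * b) * c)
    shuffle = solve-∀ ℚ-ring

  Φ-++ : ∀ ps qs → Φ (ps ++ qs) ≡ Φ ps * Φ qs
  Φ-++ []       qs = sym (*-identityˡ _)
  Φ-++ (p ∷ ps) qs = trans (cong (φ p *_) (Φ-++ ps qs)) (assoc (φ p) (Φ ps) (Φ qs))
    where
    assoc : ∀ a b c → a * (b * c) ≡ a * b * c
    assoc = solve-∀ ℚ-ring

  Ψ-++ : ∀ ps qs → Ψ (ps ++ qs) ≡ Ψ ps * Φ qs + Φ ps * Ψ qs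
  Ψ-++ []       qs = unit (Φ qs) (Ψ qs)
    where
    unit : ∀ a b → b ≡ 0ℚ * a + 1ℚ * b
    unit = solve-∀ ℚ-ring
  Ψ-++ (p ∷ ps) qs = trans (cong₂ (λ u v → φ p * u + ψ p * v) (Ψ-++ ps qs) (Φ-++ ps qs))
                           (regroup (φ p) (ψ p) (Ψ ps) (Φ ps) (Ψ qs) (Φ qs))
    where
    regroup : ∀ f g a b c d → f * (a * d + b * c) + g * (b * d) ≡ (f * a + g * b) * d + (f * b) * c
    regroup = solve-∀ ℚ-ring

  Φ-replicate : ∀ r p → Φ (replicate r p) ≡ groupΦ r p
  Φ-replicate zero    p = refl
  Φ-replicate (suc r) p = cong (φ p *_) (Φ-replicate r p)

  Ψ-replicate : ∀ r p → Ψ (replicate r p) ≡ groupΨ r p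
  Ψ-replicate zero          p = zero-left (ψ p) (φ p ^ℚ 0)
    where
    zero-left : ∀ a b → 0ℚ ≡ 0ℚ * a * b
    zero-left = solve-∀ ℚ-ring
  Ψ-replicate (suc zero)    p = unit (φ p) (ψ p)
    where
    unit : ∀ f g → f * 0ℚ + g * 1ℚ ≡ 1ℚ * g * 1ℚ
    unit = solve-∀ ℚ-ring
  Ψ-replicate (suc (suc r)) p = begin
    φ p * Ψ (replicate (suc r) p) + ψ p * Φ (replicate (suc r) p)
      ≡⟨ cong₂ (λ u v → φ p * u + ψ p * v) (Ψ-replicate (suc r) p) (Φ-replicate (suc r) p) ⟩
    φ p * (ℕtoℚ (suc r) * ψ p * φ p ^ℚ r) + ψ p * (φ p * φ p ^ℚ r)
      ≡⟨ collect (φ p) (ψ p) (φ p ^ℚ r) (ℕtoℚ (suc r)) ⟩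
    (ℕtoℚ (suc r) + 1ℚ) * ψ p * (φ p * φ p ^ℚ r)
      ≡⟨ cong (λ k → k * ψ p * φ p ^ℚ suc r) (ℕtoℚ-suc (suc r)) ⟨
    ℕtoℚ (suc (suc r)) * ψ p * φ p ^ℚ suc r ∎
    where
    collect : ∀ f g F k → f * (k * g * F) + g * (f * F) ≡ (k + 1ℚ) * g * (f * F)
    collect = solve-∀ ℚ-ring

  Φ-multipart : ∀ s (r n : Fin s → ℕ) → Φ (multipartSizes s r n) ≡ Π (λ i → groupΦ (r i) (n i))
  Φ-multipart zero    r n = refl
  Φ-multipart (suc s) r n = begin
    Φ (multipartSizes (suc s) r n)                                          ≡⟨ cong Φ (multipartSizes-suc s r n) ⟩
    Φ (replicate (r zero) (n zero) ++ multipartSizes s (r ∘ suc) (n ∘ suc)) ≡⟨ Φ-++ (replicate (r zero) (n zero)) _ ⟩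
    Φ (replicate (r zero) (n zero)) * Φ (multipartSizes s (r ∘ suc) (n ∘ suc))
      ≡⟨ cong₂ _*_ (Φ-replicate (r zero) (n zero)) (Φ-multipart s (r ∘ suc) (n ∘ suc)) ⟩
    Π (λ i → groupΦ (r i) (n i))                                                             ∎

  Ψ-multipart : ∀ s (r n : Fin s → ℕ) → Ψ (multipartSizes s r n) ≡ Σ (λ l → groupΨ (r l) (n l) * Π-except l (λ i → groupΦ (r i) (n i)))
  Ψ-multipart zero    r n = refl
  Ψ-multipart (suc s) r n = begin
    Ψ (multipartSizes (suc s) r n)
      ≡⟨ cong Ψ (multipartSizes-suc s r n) ⟩
    Ψ (replicate (r zero) (n zero) ++ multipartSizes s r′ n′)
      ≡⟨ Ψ-++ (replicate (r zero) (n zero)) _ ⟩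
    Ψ (replicate (r zero) (n zero)) * Φ (multipartSizes s r′ n′) + Φ (replicate (r zero) (n zero)) * Ψ (multipartSizes s r′ n′)
      ≡⟨ cong₂ (λ a b → a * Φ (multipartSizes s r′ n′) + b) (Ψ-replicate (r zero) (n zero))
               (cong₂ _*_ (Φ-replicate (r zero) (n zero)) (Ψ-multipart s r′ n′)) ⟩
    groupΨ (r zero) (n zero) * Φ (multipartSizes s r′ n′) + groupΦ (r zero) (n zero) * Σ (λ l → groupΨ (r′ l) (n′ l) * Π-except l (λ i → groupΦ (r′ i) (n′ i)))
      ≡⟨ cong₂ _+_ (cong (groupΨ (r zero) (n zero) *_) (Φ-multipart s r′ n′)) (tail s r n) ⟩
    Σ (λ l → groupΨ (r l) (n l) * Π-except l (λ i → groupΦ (r i) (n i))) ∎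
    where
    r′ n′ : Fin s → ℕ
    r′ = r ∘ suc
    n′ = n ∘ suc
    tail : ∀ s (r n : Fin (suc s) → ℕ) →
      groupΦ (r zero) (n zero) * Σ (λ l → groupΨ (r (suc l)) (n (suc l)) * Π-except l (λ i → groupΦ (r (suc i)) (n (suc i))))
      ≡ Σ (λ l → groupΨ (r (suc l)) (n (suc l)) * Π-except (suc l) (λ i → groupΦ (r i) (n i)))
    tail zero    r n = *-zeroʳ (groupΦ (r zero) (n zero))
    tail (suc s) r n = trans (*-distribˡ-Σ (groupΦ (r zero) (n zero)) (λ l → groupΨ (r (suc l)) (n (suc l)) * Π-except l (λ i → groupΦ (r (suc i)) (n (suc i)))))
      (Σ-cong (λ l → left-comm (groupΦ (r zero) (n zero)) (groupΨ (r (suc l)) (n (suc l))) (Π-except l (λ i → groupΦ (r (suc i)) (n (suc i))))))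
      where
      left-comm : ∀ a b c → a * (b * c) ≡ b * (a * c)
      left-comm = solve-∀ ℚ-ring

  det-multipart-factorised : ∀ s (r n : Fin s → ℕ) → (∀ i → 1 ≤ n i) → (∀ i → 1 ≤ r i) →
    Φ (multipartSizes s r n) + 1ℚ * Ψ (multipartSizes s r n)
    ≡ (y ^ℚ Σℕ (λ i → r i ℕ.* (n i ∸ 1)) * Π (λ i → w (n i) ^ℚ (r i ∸ 1)))
      * (Π (w ∘ n) + Σ (λ l → ℕtoℚ (r l) * ℕtoℚ (n l) * Π-except l (w ∘ n)))
  det-multipart-factorised s r n n≥1 r≥1 = begin
    Φ (multipartSizes s r n) + 1ℚ * Ψ (multipartSizes s r n)   ≡⟨ cong₂ (λ a b → a + 1ℚ * b) Φ≡ Ψ≡ ⟩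
    Π F * Π W + 1ℚ * (Π F * ΣW)                                 ≡⟨ factor (Π F) (Π W) ΣW ⟩
    Π F * (Π W + ΣW)                                            ≡⟨ cong (_* (Π W + ΣW)) ΠF≡ ⟩
    (y ^ℚ Σℕ (λ i → r i ℕ.* (n i ∸ 1)) * Π (λ i → w (n i) ^ℚ (r i ∸ 1))) * (Π W + ΣW) ∎
    where
    F W : Fin s → ℚ
    F i = groupFactor (r i) (n i)
    W = w ∘ n
    ΣW : ℚ
    ΣW = Σ (λ l → ℕtoℚ (r l) * ℕtoℚ (n l) * Π-except l W)

    factor : ∀ c p q → c * p + 1ℚ * (c * q) ≡ c * (p + q)
    factor = solve-∀ ℚ-ring

    groupΦ≡ : ∀ i → groupΦ (r i) (n i) ≡ F i * W i
    groupΦ≡ i = groupΦ≡groupFactor*w (r i) (n i) (r≥1 i) (n≥1 i)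

    Φ≡ : Φ (multipartSizes s r n) ≡ Π F * Π W
    Φ≡ = trans (Φ-multipart s r n) (trans (Π-cong groupΦ≡) (Π-distrib-* F W))

    summand : ∀ l → groupΨ (r l) (n l) * Π-except l (λ i → groupΦ (r i) (n i)) ≡ Π F * (ℕtoℚ (r l) * ℕtoℚ (n l) * Π-except l W)
    summand l = begin
      groupΨ (r l) (n l) * Π-except l (λ i → groupΦ (r i) (n i))
        ≡⟨ cong₂ _*_ (groupΨ≡rn*groupFactor (r l) (n l) (r≥1 l) (n≥1 l))
                     (trans (Π-except-cong l groupΦ≡) (Π-except-distrib-* l F W)) ⟩
      ℕtoℚ (r l) * ℕtoℚ (n l) * F l * (Π-except l F * Π-except l W)
        ≡⟨ shuffle (ℕtoℚ (r l)) (ℕtoℚ (n l)) (F l) (Π-except l F) (Π-except l W) ⟩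
      (F l * Π-except l F) * (ℕtoℚ (r l) * ℕtoℚ (n l) * Π-except l W)
        ≡⟨ cong (_* (ℕtoℚ (r l) * ℕtoℚ (n l) * Π-except l W)) (Π-remove l F) ⟨
      Π F * (ℕtoℚ (r l) * ℕtoℚ (n l) * Π-except l W) ∎
      where
      shuffle : ∀ R N c d e → R * N * c * (d * e) ≡ (c * d) * (R * N * e)
      shuffle = solve-∀ ℚ-ring

    Ψ≡ : Ψ (multipartSizes s r n) ≡ Π F * ΣW
    Ψ≡ = trans (Ψ-multipart s r n) (trans (Σ-cong summand) (sym (*-distribˡ-Σ (Π F) (λ l → ℕtoℚ (r l) * ℕtoℚ (n l) * Π-except l W))))

    ΠF≡ : Π F ≡ y ^ℚ Σℕ (λ i → r i ℕ.* (n i ∸ 1)) * Π (λ i → w (n i) ^ℚ (r i ∸ 1))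
    ΠF≡ = trans (Π-distrib-* (λ i → y ^ℚ (r i ℕ.* (n i ∸ 1))) (λ i → w (n i) ^ℚ (r i ∸ 1)))
                (cong (_* Π (λ i → w (n i) ^ℚ (r i ∸ 1))) (Π-^ℚ y (λ i → r i ℕ.* (n i ∸ 1))))

esym : ℕ → List ℕ → ℕ
esym zero    zs       = 1
esym (suc i) []       = 0
esym (suc i) (z ∷ zs) = z ℕ.* esym i zs ℕ.+ esym (suc i) zs

esym-vanishes : ∀ i zs → length zs < i → esym i zs ≡ 0
esym-vanishes (suc i) []       _         = refl
esym-vanishes (suc i) (z ∷ zs) (s≤s len<i) = begin
  z ℕ.* esym i zs ℕ.+ esym (suc i) zs ≡⟨ cong₂ (λ a b → z ℕ.* a ℕ.+ b) (esym-vanishes i zs len<i)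
                                           (esym-vanishes (suc i) zs (ℕₚ.m<n⇒m<1+n len<i)) ⟩
  z ℕ.* 0 ℕ.+ 0                       ≡⟨ trans (ℕₚ.+-identityʳ (z ℕ.* 0)) (ℕₚ.*-zeroʳ z) ⟩
  0                                   ∎

sum-map-*ˡ : ∀ {A : Set} (c : ℕ) (g : A → ℕ) (xs : List A) → sum (map (λ a → c ℕ.* g a) xs) ≡ c ℕ.* sum (map g xs)
sum-map-*ˡ c g []       = sym (ℕₚ.*-zeroʳ c)
sum-map-*ˡ c g (a ∷ xs) = trans (cong (c ℕ.* g a ℕ.+_) (sum-map-*ˡ c g xs)) (sym (ℕₚ.*-distribˡ-+ c (g a) _))

sum-product-choose : ∀ {A : Set} (f : A → ℕ) (xs : List A) i →
  sum (map (product ∘ map f) (choose i xs)) ≡ esym i (map f xs)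
sum-product-choose f xs       zero    = refl
sum-product-choose f []       (suc i) = refl
sum-product-choose {A} f (x ∷ xs) (suc i) = begin
  sum (map P (map (x ∷_) (choose i xs) ++ choose (suc i) xs))
    ≡⟨ cong sum (map-++ P (map (x ∷_) (choose i xs)) (choose (suc i) xs)) ⟩
  sum (map P (map (x ∷_) (choose i xs)) ++ map P (choose (suc i) xs))
    ≡⟨ sum-++ (map P (map (x ∷_) (choose i xs))) (map P (choose (suc i) xs)) ⟩
  sum (map P (map (x ∷_) (choose i xs))) ℕ.+ sum (map P (choose (suc i) xs))
    ≡⟨ cong (ℕ._+ sum (map P (choose (suc i) xs))) (trans (cong sum (sym (map-∘ (choose i xs)))) (sum-map-*ˡ (f x) P (choose i xs))) ⟩
  f x ℕ.* sum (map P (choose i xs)) ℕ.+ sum (map P (choose (suc i) xs))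
    ≡⟨ cong₂ (λ a b → f x ℕ.* a ℕ.+ b) (sum-product-choose f xs i) (sum-product-choose f xs (suc i)) ⟩
  f x ℕ.* esym i (map f xs) ℕ.+ esym (suc i) (map f xs) ∎
  where
  P : List A → ℕ
  P = product ∘ map f

σ≡esym : ∀ s (n : Fin s → ℕ) i → σ s n i ≡ esym i (map n (allFin s))
σ≡esym s n = sum-product-choose n (allFin s)

σl≡n*esym : ∀ s (n : Fin s → ℕ) l i → σl s n l (suc i) ≡ n l ℕ.* esym i (map n (others s l))
σl≡n*esym s n l zero    = sym (ℕₚ.*-identityʳ (n l))
σl≡n*esym s n l (suc j) = trans (sum-map-*ˡ (n l) (product ∘ map n) (choose (suc j) (others s l)))
                                (cong (n l ℕ.*_) (sum-product-choose n (others s l) (suc j)))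

others≡map-punchIn : ∀ s (l : Fin (suc s)) → others (suc s) l ≡ map (punchIn l) (allFin s)
others≡map-punchIn s       zero    = trans (cong (filter (λ j → ¬? (j Fin.≟ zero))) (allFin-suc s)) (drop-none (allFin s))
  where
  allFin-suc : ∀ m → tabulate {n = m} (Fin.suc {m}) ≡ map Fin.suc (allFin m)
  allFin-suc m = sym (map-tabulate (λ i → i) Fin.suc)
  drop-none : ∀ {m} (js : List (Fin m)) → filter (λ j → ¬? (j Fin.≟ zero)) (map Fin.suc js) ≡ map Fin.suc js
  drop-none []       = refl
  drop-none (j ∷ js) = cong (suc j ∷_) (drop-none js)
others≡map-punchIn (suc s) (suc l) = cong (zero ∷_) (begin
  filter (λ j → ¬? (j Fin.≟ suc l)) (tabulate Fin.suc)          ≡⟨ cong (filter (λ j → ¬? (j Fin.≟ suc l))) (sym (map-tabulate (λ i → i) suc)) ⟩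
  filter (λ j → ¬? (j Fin.≟ suc l)) (map suc (allFin (suc s)))  ≡⟨ filter-suc (allFin (suc s)) ⟩
  map suc (others (suc s) l)                                     ≡⟨ cong (map suc) (others≡map-punchIn s l) ⟩
  map suc (map (punchIn l) (allFin s))                           ≡⟨ map-∘ (allFin s) ⟨
  map (suc ∘ punchIn l) (allFin s)                               ≡⟨ map-tabulate (λ i → i) (suc ∘ punchIn l) ⟩
  tabulate (suc ∘ punchIn l)                                     ≡⟨ map-tabulate suc (punchIn (suc l)) ⟨
  map (punchIn (suc l)) (tabulate Fin.suc)                       ∎)
  where
  filter-suc : ∀ js → filter (λ j → ¬? (j Fin.≟ suc l)) (map Fin.suc js) ≡ map Fin.suc (filter (λ j → ¬? (j Fin.≟ l)) js)
  filter-suc []       = refl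
  filter-suc (j ∷ js) with does (j Fin.≟ l)
  ... | true  = filter-suc js
  ... | false = cong (suc j ∷_) (filter-suc js)

length-map-allFin : ∀ {A : Set} s (f : Fin s → A) → length (map f (allFin s)) ≡ s
length-map-allFin s f = trans (length-map f (allFin s)) (length-tabulate (λ i → i))

length-map-others : ∀ s (l : Fin (suc s)) (n : Fin (suc s) → ℕ) → length (map n (others (suc s) l)) ≡ s
length-map-others s l n = begin
  length (map n (others (suc s) l))      ≡⟨ length-map n (others (suc s) l) ⟩
  length (others (suc s) l)              ≡⟨ cong length (others≡map-punchIn s l) ⟩
  length (map (punchIn l) (allFin s))    ≡⟨ length-map-allFin s (punchIn l) ⟩
  s                                      ∎

Σ< : ℕ → (ℕ → ℚ) → ℚ
Σ< zero    f = 0ℚ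
Σ< (suc N) f = f 0 + Σ< N (f ∘ suc)

Σ<-cong : ∀ N {f g : ℕ → ℚ} → (∀ i → i < N → f i ≡ g i) → Σ< N f ≡ Σ< N g
Σ<-cong zero    e = refl
Σ<-cong (suc N) e = cong₂ _+_ (e 0 (s≤s z≤n)) (Σ<-cong N (λ i i<N → e (suc i) (s≤s i<N)))

Σ<-distrib-+ : ∀ N (f g : ℕ → ℚ) → Σ< N (λ i → f i + g i) ≡ Σ< N f + Σ< N g
Σ<-distrib-+ zero    f g = refl
Σ<-distrib-+ (suc N) f g = trans (cong ((f 0 + g 0) +_) (Σ<-distrib-+ N (f ∘ suc) (g ∘ suc)))
                                 (interchange (f 0) (g 0) _ _)
  where
  interchange : ∀ a b c d → (a + b) + (c + d) ≡ (a + c) + (b + d)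
  interchange = solve-∀ ℚ-ring

*-distribˡ-Σ< : ∀ N c (f : ℕ → ℚ) → c * Σ< N f ≡ Σ< N (λ i → c * f i)
*-distribˡ-Σ< zero    c f = *-zeroʳ c
*-distribˡ-Σ< (suc N) c f = trans (distrib c (f 0) _) (cong (c * f 0 +_) (*-distribˡ-Σ< N c (f ∘ suc)))
  where
  distrib : ∀ c a b → c * (a + b) ≡ c * a + c * b
  distrib = solve-∀ ℚ-ring

Σ<-last : ∀ N (f : ℕ → ℚ) → Σ< (suc N) f ≡ Σ< N f + f N
Σ<-last zero    f = comm (f 0)
  where
  comm : ∀ a → a + 0ℚ ≡ 0ℚ + a
  comm = solve-∀ ℚ-ring
Σ<-last (suc N) f = trans (cong (f 0 +_) (Σ<-last N (f ∘ suc))) (assoc (f 0) _ _)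
  where
  assoc : ∀ a b c → a + (b + c) ≡ a + b + c
  assoc = solve-∀ ℚ-ring

Σ≡Σ< : ∀ {N} (f : ℕ → ℚ) → Σ {N} (f ∘ toℕ) ≡ Σ< N f
Σ≡Σ< {zero}  f = refl
Σ≡Σ< {suc N} f = cong (f 0 +_) (Σ≡Σ< {N} (f ∘ suc))

Σ<-Σ-comm : ∀ N {m} (F : Fin m → ℕ → ℚ) → Σ< N (λ i → Σ (λ l → F l i)) ≡ Σ (λ l → Σ< N (F l))
Σ<-Σ-comm zero    {m} F = sym (Σ-zero {m} {λ _ → 0ℚ} (λ _ → refl))
Σ<-Σ-comm (suc N)     F = trans (cong (Σ (λ l → F l 0) +_) (Σ<-Σ-comm N (λ l → F l ∘ suc)))
                                (sym (Σ-distrib-+ (λ l → F l 0) (λ l → Σ< N (F l ∘ suc))))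

suc-∸ : ∀ {m N} → m ≤ N → suc N ∸ m ≡ suc (N ∸ m)
suc-∸ m≤N = ℕₚ.+-∸-assoc 1 m≤N

binomial : ∀ x N → Σ< (suc N) (λ m → ℕtoℚ (N C m) * x ^ℚ (N ∸ m)) ≡ (x + 1ℚ) ^ℚ N
binomial x zero    = unit x
  where
  unit : ∀ x → 1ℚ * 1ℚ + 0ℚ ≡ 1ℚ
  unit = solve-∀ ℚ-ring
binomial x (suc N) = begin
  ℕtoℚ 1 * x ^ℚ suc N + Σ< (suc N) (λ m → ℕtoℚ (suc N C suc m) * x ^ℚ (N ∸ m))
    ≡⟨ cong (ℕtoℚ 1 * x ^ℚ suc N +_) (trans (Σ<-cong (suc N) pascal) (Σ<-distrib-+ (suc N) lower upper)) ⟩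
  ℕtoℚ 1 * x ^ℚ suc N + (Σ< (suc N) lower + Σ< (suc N) upper)
    ≡⟨ cong₂ (λ a b → ℕtoℚ 1 * x ^ℚ suc N + (a + b)) (binomial x N) (Σ<-last N upper) ⟩
  ℕtoℚ 1 * x ^ℚ suc N + ((x + 1ℚ) ^ℚ N + (Σ< N upper + upper N))
    ≡⟨ cong₂ (λ a b → ℕtoℚ 1 * x ^ℚ suc N + ((x + 1ℚ) ^ℚ N + (a + b))) shifted top ⟩
  ℕtoℚ 1 * x ^ℚ suc N + ((x + 1ℚ) ^ℚ N + ((x * (x + 1ℚ) ^ℚ N - ℕtoℚ 1 * x ^ℚ suc N) + 0ℚ))
    ≡⟨ collect x (x ^ℚ suc N) ((x + 1ℚ) ^ℚ N) ⟩
  (x + 1ℚ) * (x + 1ℚ) ^ℚ N ∎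
  where
  lower upper : ℕ → ℚ
  lower m = ℕtoℚ (N C m) * x ^ℚ (N ∸ m)
  upper m = ℕtoℚ (N C suc m) * x ^ℚ (N ∸ m)

  collect : ∀ x X U → ℕtoℚ 1 * X + (U + ((x * U - ℕtoℚ 1 * X) + 0ℚ)) ≡ (x + 1ℚ) * U
  collect = solve-∀ ℚ-ring

  pascal : ∀ m → m < suc N → ℕtoℚ (suc N C suc m) * x ^ℚ (N ∸ m) ≡ lower m + upper m
  pascal m _ = begin
    ℕtoℚ (suc N C suc m) * x ^ℚ (N ∸ m)                   ≡⟨ cong (λ k → ℕtoℚ k * x ^ℚ (N ∸ m)) (nCk+nC[k+1]≡[n+1]C[k+1] N m) ⟨
    ℕtoℚ (N C m ℕ.+ N C suc m) * x ^ℚ (N ∸ m)             ≡⟨ cong (_* x ^ℚ (N ∸ m)) (ℕtoℚ-+ (N C m) (N C suc m)) ⟩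
    (ℕtoℚ (N C m) + ℕtoℚ (N C suc m)) * x ^ℚ (N ∸ m)      ≡⟨ distrib (ℕtoℚ (N C m)) (ℕtoℚ (N C suc m)) (x ^ℚ (N ∸ m)) ⟩
    lower m + upper m                                      ∎
    where
    distrib : ∀ a b c → (a + b) * c ≡ a * c + b * c
    distrib = solve-∀ ℚ-ring

  top : upper N ≡ 0ℚ
  top = trans (cong (λ k → ℕtoℚ k * x ^ℚ (N ∸ N)) (k>n⇒nCk≡0 (ℕₚ.n<1+n N))) (zero-left (x ^ℚ (N ∸ N)))
    where
    zero-left : ∀ a → ℕtoℚ 0 * a ≡ 0ℚ
    zero-left = solve-∀ ℚ-ring

  shifted : Σ< N upper ≡ x * (x + 1ℚ) ^ℚ N - ℕtoℚ 1 * x ^ℚ suc N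
  shifted = begin
    Σ< N upper                                                       ≡⟨ isolate (Σ< N upper) (ℕtoℚ 1 * x ^ℚ suc N) ⟩
    (ℕtoℚ 1 * x ^ℚ suc N + Σ< N upper) - ℕtoℚ 1 * x ^ℚ suc N          ≡⟨ cong (_- ℕtoℚ 1 * x ^ℚ suc N) x*lower ⟨
    x * Σ< (suc N) lower - ℕtoℚ 1 * x ^ℚ suc N                       ≡⟨ cong (λ b → x * b - ℕtoℚ 1 * x ^ℚ suc N) (binomial x N) ⟩
    x * (x + 1ℚ) ^ℚ N - ℕtoℚ 1 * x ^ℚ suc N                          ∎
    where
    isolate : ∀ a b → a ≡ (b + a) - b
    isolate = solve-∀ ℚ-ring
    x*lower : x * Σ< (suc N) lower ≡ ℕtoℚ 1 * x ^ℚ suc N + Σ< N upper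
    x*lower = trans (*-distribˡ-Σ< (suc N) x lower) (Σ<-cong (suc N) (λ m m<1+N →
      trans (left-comm x (ℕtoℚ (N C m)) (x ^ℚ (N ∸ m))) (cong (λ e → ℕtoℚ (N C m) * x ^ℚ e) (sym (suc-∸ (ℕₚ.≤-pred m<1+N))))))
      where
      left-comm : ∀ a b c → a * (b * c) ≡ b * (a * c)
      left-comm = solve-∀ ℚ-ring

minus2^ : ℕ → ℚ
minus2^ i = sign i * ℕtoℚ 2 ^ℚ i

minus2^-suc : ∀ i → minus2^ (suc i) ≡ - ℕtoℚ 2 * minus2^ i
minus2^-suc i = trans (cong (_* (ℕtoℚ 2 * ℕtoℚ 2 ^ℚ i)) (sign-suc i)) (shuffle (sign i) (ℕtoℚ 2) (ℕtoℚ 2 ^ℚ i))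
  where
  shuffle : ∀ s t p → - s * (t * p) ≡ - t * (s * p)
  shuffle = solve-∀ ℚ-ring

-[coef*2]≡minus2^ : ∀ i → - (coef i * ℕtoℚ 2) ≡ minus2^ i
-[coef*2]≡minus2^ zero    = refl
-[coef*2]≡minus2^ (suc j) = trans (shuffle (sign j) (ℕtoℚ 2 ^ℚ j) (ℕtoℚ 2)) (sym (minus2^-suc j))
  where
  shuffle : ∀ s p t → - (s * p * t) ≡ - t * (s * p)
  shuffle = solve-∀ ℚ-ring

module Expansion (x : ℚ) where
  y : ℚ
  y = x + 1ℚ
  open LabelMatrix y using (w)

  binomial-double-sum : ∀ s (a : ℕ → ℚ) →
    Σ< (suc s) (λ m → Σ< (suc m) (λ i → a i * ℕtoℚ ((s ∸ i) C (m ∸ i)) * x ^ℚ (s ∸ m))) ≡ Σ< (suc s) (λ i → a i * y ^ℚ (s ∸ i))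
  binomial-double-sum zero    a = drop-zeros (a 0)
    where
    drop-zeros : ∀ a → (a * 1ℚ * 1ℚ + 0ℚ) + 0ℚ ≡ a * 1ℚ + 0ℚ
    drop-zeros = solve-∀ ℚ-ring
  binomial-double-sum (suc s) a = begin
    Σ< (suc (suc s)) (λ m → G 0 m + Σ< m (λ i → G (suc i) m))
      ≡⟨ Σ<-distrib-+ (suc (suc s)) (G 0) (λ m → Σ< m (λ i → G (suc i) m)) ⟩
    Σ< (suc (suc s)) (G 0) + (0ℚ + Σ< (suc s) (λ m → Σ< (suc m) (λ i → G (suc i) (suc m))))
      ≡⟨ cong₂ _+_ first (trans (+-identityˡ _) (binomial-double-sum s (a ∘ suc))) ⟩
    a 0 * y ^ℚ suc s + Σ< (suc s) (λ i → a (suc i) * y ^ℚ (s ∸ i)) ∎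
    where
    G : ℕ → ℕ → ℚ
    G i m = a i * ℕtoℚ ((suc s ∸ i) C (m ∸ i)) * x ^ℚ (suc s ∸ m)
    first : Σ< (suc (suc s)) (G 0) ≡ a 0 * y ^ℚ suc s
    first = begin
      Σ< (suc (suc s)) (G 0)                                               ≡⟨ Σ<-cong (suc (suc s)) (λ m _ → assoc (a 0) (ℕtoℚ (suc s C m)) (x ^ℚ (suc s ∸ m))) ⟩
      Σ< (suc (suc s)) (λ m → a 0 * (ℕtoℚ (suc s C m) * x ^ℚ (suc s ∸ m)))  ≡⟨ *-distribˡ-Σ< (suc (suc s)) (a 0) (λ m → ℕtoℚ (suc s C m) * x ^ℚ (suc s ∸ m)) ⟨
      a 0 * Σ< (suc (suc s)) (λ m → ℕtoℚ (suc s C m) * x ^ℚ (suc s ∸ m))    ≡⟨ cong (a 0 *_) (binomial x (suc s)) ⟩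
      a 0 * y ^ℚ suc s                                                     ∎
      where
      assoc : ∀ a b c → a * b * c ≡ a * (b * c)
      assoc = solve-∀ ℚ-ring

  Πw : List ℕ → ℚ
  Πw []       = 1ℚ
  Πw (z ∷ zs) = w z * Πw zs

  vieta : ∀ zs → Πw zs ≡ Σ< (suc (length zs)) (λ i → minus2^ i * ℕtoℚ (esym i zs) * y ^ℚ (length zs ∸ i))
  vieta []       = unit
    where
    unit : 1ℚ ≡ 1ℚ * 1ℚ * 1ℚ + 0ℚ
    unit = solve-∀ ℚ-ring
  vieta (z ∷ zs) = begin
    w z * Πw zs                                    ≡⟨ cong (w z *_) (vieta zs) ⟩
    (y - ℕtoℚ 2 * ℕtoℚ z) * ΣB                     ≡⟨ distrib y (ℕtoℚ z) ΣB ⟩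
    y * ΣB + (- ℕtoℚ 2 * ℕtoℚ z) * ΣB              ≡⟨ cong₂ _+_ y*ΣB (sym z-part) ⟩
    (lead + Σ< L upper) + Σ< (suc L) z-terms       ≡⟨ regroup lead (Σ< L upper) (Σ< (suc L) z-terms) ⟩
    lead + (Σ< (suc L) z-terms + (Σ< L upper + 0ℚ)) ≡⟨ cong (λ t → lead + (Σ< (suc L) z-terms + t)) (sym upper-part) ⟩
    lead + (Σ< (suc L) z-terms + Σ< (suc L) upper)  ≡⟨ cong (lead +_) (sym (trans (Σ<-cong (suc L) (λ i _ → split i))
                                                                                 (Σ<-distrib-+ (suc L) z-terms upper))) ⟩
    lead + Σ< (suc L) (λ i → minus2^ (suc i) * ℕtoℚ (esym (suc i) (z ∷ zs)) * y ^ℚ (L ∸ i)) ∎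
    where
    L : ℕ
    L = length zs
    B : ℕ → ℚ
    B i = minus2^ i * ℕtoℚ (esym i zs) * y ^ℚ (L ∸ i)
    ΣB lead : ℚ
    ΣB = Σ< (suc L) B
    lead = minus2^ 0 * ℕtoℚ 1 * y ^ℚ suc L
    z-terms upper : ℕ → ℚ
    z-terms i = minus2^ (suc i) * (ℕtoℚ z * ℕtoℚ (esym i zs)) * y ^ℚ (L ∸ i)
    upper   i = minus2^ (suc i) * ℕtoℚ (esym (suc i) zs) * y ^ℚ (L ∸ i)

    distrib : ∀ y z b → (y - ℕtoℚ 2 * z) * b ≡ y * b + (- ℕtoℚ 2 * z) * b
    distrib = solve-∀ ℚ-ring
    regroup : ∀ h u v → (h + u) + v ≡ h + (v + (u + 0ℚ))
    regroup = solve-∀ ℚ-ring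

    split : ∀ i → minus2^ (suc i) * ℕtoℚ (z ℕ.* esym i zs ℕ.+ esym (suc i) zs) * y ^ℚ (L ∸ i) ≡ z-terms i + upper i
    split i = trans (cong (λ q → minus2^ (suc i) * q * y ^ℚ (L ∸ i))
                          (trans (ℕtoℚ-+ (z ℕ.* esym i zs) _) (cong (_+ ℕtoℚ (esym (suc i) zs)) (ℕtoℚ-* z (esym i zs)))))
                    (distrib′ (minus2^ (suc i)) (ℕtoℚ z * ℕtoℚ (esym i zs)) (ℕtoℚ (esym (suc i) zs)) (y ^ℚ (L ∸ i)))
      where
      distrib′ : ∀ s a b Y → s * (a + b) * Y ≡ s * a * Y + s * b * Y
      distrib′ = solve-∀ ℚ-ring

    z-part : Σ< (suc L) z-terms ≡ (- ℕtoℚ 2 * ℕtoℚ z) * ΣB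
    z-part = trans (Σ<-cong (suc L) (λ i _ → trans (cong (λ q → q * (ℕtoℚ z * ℕtoℚ (esym i zs)) * y ^ℚ (L ∸ i)) (minus2^-suc i))
                                                  (shuffle (ℕtoℚ 2) (minus2^ i) (ℕtoℚ z) (ℕtoℚ (esym i zs)) (y ^ℚ (L ∸ i)))))
                   (sym (*-distribˡ-Σ< (suc L) (- ℕtoℚ 2 * ℕtoℚ z) B))
      where
      shuffle : ∀ t s z e Y → - t * s * (z * e) * Y ≡ (- t * z) * (s * e * Y)
      shuffle = solve-∀ ℚ-ring

    upper-part : Σ< (suc L) upper ≡ Σ< L upper + 0ℚ
    upper-part = trans (Σ<-last L upper) (cong (Σ< L upper +_)
      (trans (cong (λ e → minus2^ (suc L) * ℕtoℚ e * y ^ℚ (L ∸ L)) (esym-vanishes (suc L) zs (ℕₚ.n<1+n L)))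
             (zero-mid (minus2^ (suc L)) (y ^ℚ (L ∸ L)))))
      where
      zero-mid : ∀ a b → a * ℕtoℚ 0 * b ≡ 0ℚ
      zero-mid = solve-∀ ℚ-ring

    y*ΣB : y * ΣB ≡ lead + Σ< L upper
    y*ΣB = trans (*-distribˡ-Σ< (suc L) y B) (Σ<-cong (suc L) (λ i i<1+L →
      trans (left-comm y (minus2^ i * ℕtoℚ (esym i zs)) (y ^ℚ (L ∸ i)))
            (cong (λ e → minus2^ i * ℕtoℚ (esym i zs) * y ^ℚ e) (sym (suc-∸ (ℕₚ.≤-pred i<1+L))))))
      where
      left-comm : ∀ a b c → a * (b * c) ≡ b * (a * c)
      left-comm = solve-∀ ℚ-ring

  Πw-allFin : ∀ m (f : Fin m → ℕ) → Πw (map f (allFin m)) ≡ Π (w ∘ f)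
  Πw-allFin zero    f = refl
  Πw-allFin (suc m) f = cong (w (f zero) *_) (trans (cong Πw (trans (map-tabulate Fin.suc f) (sym (map-tabulate (λ i → i) (f ∘ suc)))))
                                                    (Πw-allFin m (f ∘ suc)))

  Πw-others : ∀ s (n : Fin (suc s) → ℕ) l → Πw (map n (others (suc s) l)) ≡ Π-except l (w ∘ n)
  Πw-others s n l = begin
    Πw (map n (others (suc s) l))           ≡⟨ cong (Πw ∘ map n) (others≡map-punchIn s l) ⟩
    Πw (map n (map (punchIn l) (allFin s))) ≡⟨ cong Πw (map-∘ (allFin s)) ⟨
    Πw (map (n ∘ punchIn l) (allFin s))     ≡⟨ Πw-allFin s (n ∘ punchIn l) ⟩
    Π-except l (w ∘ n)                      ∎

  vieta-length : ∀ zs {L} → length zs ≡ L → Πw zs ≡ Σ< (suc L) (λ i → minus2^ i * ℕtoℚ (esym i zs) * y ^ℚ (L ∸ i))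
  vieta-length zs refl = vieta zs

  vieta-σ : ∀ s (n : Fin s → ℕ) → Σ< (suc s) (λ i → minus2^ i * ℕtoℚ (σ s n i) * y ^ℚ (s ∸ i)) ≡ Π (w ∘ n)
  vieta-σ s n = begin
    Σ< (suc s) (λ i → minus2^ i * ℕtoℚ (σ s n i) * y ^ℚ (s ∸ i))
      ≡⟨ Σ<-cong (suc s) (λ i _ → cong (λ e → minus2^ i * ℕtoℚ e * y ^ℚ (s ∸ i)) (σ≡esym s n i)) ⟩
    Σ< (suc s) (λ i → minus2^ i * ℕtoℚ (esym i (map n (allFin s))) * y ^ℚ (s ∸ i))
      ≡⟨ vieta-length (map n (allFin s)) (length-map-allFin s n) ⟨
    Πw (map n (allFin s))
      ≡⟨ Πw-allFin s n ⟩
    Π (w ∘ n) ∎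

  vieta-σl : ∀ s (n : Fin s → ℕ) l → Σ< (suc s) (λ i → coef i * ℕtoℚ (σl s n l i) * y ^ℚ (s ∸ i)) ≡ ℕtoℚ (n l) * Π-except l (w ∘ n)
  vieta-σl (suc s) n l = begin
    coef 0 * ℕtoℚ 0 * y ^ℚ suc s + Σ< (suc s) (λ i → minus2^ i * ℕtoℚ (σl (suc s) n l (suc i)) * y ^ℚ (s ∸ i))
      ≡⟨ cong₂ _+_ (zero-mid (coef 0) (y ^ℚ suc s)) (Σ<-cong (suc s) (λ i _ → factor-n i)) ⟩
    0ℚ + Σ< (suc s) (λ i → ℕtoℚ (n l) * (minus2^ i * ℕtoℚ (esym i zs) * y ^ℚ (s ∸ i)))
      ≡⟨ +-identityˡ _ ⟩
    Σ< (suc s) (λ i → ℕtoℚ (n l) * (minus2^ i * ℕtoℚ (esym i zs) * y ^ℚ (s ∸ i)))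
      ≡⟨ *-distribˡ-Σ< (suc s) (ℕtoℚ (n l)) (λ i → minus2^ i * ℕtoℚ (esym i zs) * y ^ℚ (s ∸ i)) ⟨
    ℕtoℚ (n l) * Σ< (suc s) (λ i → minus2^ i * ℕtoℚ (esym i zs) * y ^ℚ (s ∸ i))
      ≡⟨ cong (ℕtoℚ (n l) *_) (sym (trans (sym (Πw-others s n l)) (vieta-length zs (length-map-others s l n)))) ⟩
    ℕtoℚ (n l) * Π-except l (w ∘ n) ∎
    where
    zs : List ℕ
    zs = map n (others (suc s) l)
    zero-mid : ∀ a b → a * ℕtoℚ 0 * b ≡ 0ℚ
    zero-mid = solve-∀ ℚ-ring
    factor-n : ∀ i → minus2^ i * ℕtoℚ (σl (suc s) n l (suc i)) * y ^ℚ (s ∸ i)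
                     ≡ ℕtoℚ (n l) * (minus2^ i * ℕtoℚ (esym i zs) * y ^ℚ (s ∸ i))
    factor-n i = trans (cong (λ q → minus2^ i * q * y ^ℚ (s ∸ i)) (trans (cong ℕtoℚ (σl≡n*esym (suc s) n l i)) (ℕtoℚ-* (n l) _)))
                       (shuffle (minus2^ i) (ℕtoℚ (n l)) (ℕtoℚ (esym i zs)) (y ^ℚ (s ∸ i)))
      where
      shuffle : ∀ a b c d → a * (b * c) * d ≡ b * (a * c * d)
      shuffle = solve-∀ ℚ-ring

  residualFactor : (s : ℕ) → (r n : Fin s → ℕ) → ℚ
  residualFactor s r n =
    (x ^ℚ s)
    + Σ {s} (λ m′ → let m = suc (toℕ m′) in
        Σ {suc m} (λ i′ → let i = toℕ i′ in
          coef i * ℕtoℚ ((s ∸ i) C (m ∸ i))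
          * (Σ (λ l → ℕtoℚ (r l) * ℕtoℚ (σl s n l i)) - ℕtoℚ 2 * ℕtoℚ (σ s n i))
          * (x ^ℚ (s ∸ m))))

  residualFactor≡ : ∀ s (r n : Fin s → ℕ) →
    residualFactor s r n ≡ Π (w ∘ n) + Σ (λ l → ℕtoℚ (r l) * ℕtoℚ (n l) * Π-except l (w ∘ n))
  residualFactor≡ s r n = begin
    residualFactor s r n
      ≡⟨ as-double-sum ⟩
    Σ< (suc s) (λ m → Σ< (suc m) (λ i → a i * ℕtoℚ ((s ∸ i) C (m ∸ i)) * x ^ℚ (s ∸ m)))
      ≡⟨ binomial-double-sum s a ⟩
    Σ< (suc s) (λ i → a i * y ^ℚ (s ∸ i))
      ≡⟨ trans (Σ<-cong (suc s) (λ i _ → split i)) (Σ<-distrib-+ (suc s) (λ i → coef i * ΣR i * y ^ℚ (s ∸ i)) (λ i → minus2^ i * ℕtoℚ (σ s n i) * y ^ℚ (s ∸ i))) ⟩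
    Σ< (suc s) (λ i → coef i * ΣR i * y ^ℚ (s ∸ i)) + Σ< (suc s) (λ i → minus2^ i * ℕtoℚ (σ s n i) * y ^ℚ (s ∸ i))
      ≡⟨ cong₂ _+_ ΣR-part (vieta-σ s n) ⟩
    Σ (λ l → ℕtoℚ (r l) * ℕtoℚ (n l) * Π-except l (w ∘ n)) + Π (w ∘ n)
      ≡⟨ +-comm _ (Π (w ∘ n)) ⟩
    Π (w ∘ n) + Σ (λ l → ℕtoℚ (r l) * ℕtoℚ (n l) * Π-except l (w ∘ n)) ∎
    where
    ΣR : ℕ → ℚ
    ΣR i = Σ (λ l → ℕtoℚ (r l) * ℕtoℚ (σl s n l i))
    a : ℕ → ℚ
    a i = coef i * (ΣR i - ℕtoℚ 2 * ℕtoℚ (σ s n i))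

    a0≡1 : a 0 ≡ 1ℚ
    a0≡1 = trans (cong (λ q → coef 0 * (q - ℕtoℚ 2 * ℕtoℚ 1)) (Σ-zero {f = λ l → ℕtoℚ (r l) * ℕtoℚ 0} (λ l → *-zeroʳ (ℕtoℚ (r l))))) value
      where
      value : coef 0 * (0ℚ - ℕtoℚ 2 * ℕtoℚ 1) ≡ 1ℚ
      value = solve-∀ ℚ-ring

    as-double-sum : residualFactor s r n ≡ Σ< (suc s) (λ m → Σ< (suc m) (λ i → a i * ℕtoℚ ((s ∸ i) C (m ∸ i)) * x ^ℚ (s ∸ m)))
    as-double-sum = cong₂ _+_
      (trans (pad (x ^ℚ s)) (cong (λ q → q * 1ℚ * x ^ℚ s + 0ℚ) (sym a0≡1)))
      (begin
        Σ {s} (λ m′ → Σ {suc (suc (toℕ m′))} (λ i′ → term (toℕ i′) (suc (toℕ m′))))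
          ≡⟨ Σ-cong {s} (λ m′ → Σ≡Σ< {suc (suc (toℕ m′))} (λ i → term i (suc (toℕ m′)))) ⟩
        Σ {s} (λ m′ → Σ< (suc (suc (toℕ m′))) (λ i → term i (suc (toℕ m′))))
          ≡⟨ Σ≡Σ< {s} (λ m → Σ< (suc (suc m)) (λ i → term i (suc m))) ⟩
        Σ< s (λ m → Σ< (suc (suc m)) (λ i → term i (suc m)))
          ≡⟨ Σ<-cong s (λ m _ → Σ<-cong (suc (suc m)) (λ i _ → swap (coef i) (ℕtoℚ ((s ∸ i) C (suc m ∸ i))) (ΣR i - ℕtoℚ 2 * ℕtoℚ (σ s n i)) (x ^ℚ (s ∸ suc m)))) ⟩
        Σ< s (λ m → Σ< (suc (suc m)) (λ i → a i * ℕtoℚ ((s ∸ i) C (suc m ∸ i)) * x ^ℚ (s ∸ suc m))) ∎)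
      where
      term : ℕ → ℕ → ℚ
      term i m = coef i * ℕtoℚ ((s ∸ i) C (m ∸ i)) * (ΣR i - ℕtoℚ 2 * ℕtoℚ (σ s n i)) * x ^ℚ (s ∸ m)
      pad : ∀ X → X ≡ 1ℚ * 1ℚ * X + 0ℚ
      pad = solve-∀ ℚ-ring
      swap : ∀ c b a X → c * b * a * X ≡ c * a * b * X
      swap = solve-∀ ℚ-ring

    split : ∀ i → a i * y ^ℚ (s ∸ i) ≡ coef i * ΣR i * y ^ℚ (s ∸ i) + minus2^ i * ℕtoℚ (σ s n i) * y ^ℚ (s ∸ i)
    split i = trans (distrib (coef i) (ΣR i) (ℕtoℚ 2) (ℕtoℚ (σ s n i)) (y ^ℚ (s ∸ i)))
                    (cong (λ q → coef i * ΣR i * y ^ℚ (s ∸ i) + q * ℕtoℚ (σ s n i) * y ^ℚ (s ∸ i)) (-[coef*2]≡minus2^ i))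
      where
      distrib : ∀ c R t σ Y → c * (R - t * σ) * Y ≡ c * R * Y + - (c * t) * σ * Y
      distrib = solve-∀ ℚ-ring

    ΣR-part : Σ< (suc s) (λ i → coef i * ΣR i * y ^ℚ (s ∸ i)) ≡ Σ (λ l → ℕtoℚ (r l) * ℕtoℚ (n l) * Π-except l (w ∘ n))
    ΣR-part = begin
      Σ< (suc s) (λ i → coef i * ΣR i * y ^ℚ (s ∸ i))
        ≡⟨ Σ<-cong (suc s) (λ i _ → spread i) ⟩
      Σ< (suc s) (λ i → Σ (λ l → ℕtoℚ (r l) * (coef i * ℕtoℚ (σl s n l i) * y ^ℚ (s ∸ i))))
        ≡⟨ Σ<-Σ-comm (suc s) (λ l i → ℕtoℚ (r l) * (coef i * ℕtoℚ (σl s n l i) * y ^ℚ (s ∸ i))) ⟩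
      Σ (λ l → Σ< (suc s) (λ i → ℕtoℚ (r l) * (coef i * ℕtoℚ (σl s n l i) * y ^ℚ (s ∸ i))))
        ≡⟨ Σ-cong (λ l → trans (sym (*-distribˡ-Σ< (suc s) (ℕtoℚ (r l)) (λ i → coef i * ℕtoℚ (σl s n l i) * y ^ℚ (s ∸ i))))
                               (trans (cong (ℕtoℚ (r l) *_) (vieta-σl s n l)) (assoc (ℕtoℚ (r l)) (ℕtoℚ (n l)) (Π-except l (w ∘ n))))) ⟩
      Σ (λ l → ℕtoℚ (r l) * ℕtoℚ (n l) * Π-except l (w ∘ n)) ∎
      where
      assoc : ∀ a b c → a * (b * c) ≡ a * b * c
      assoc = solve-∀ ℚ-ring
      spread : ∀ i → coef i * ΣR i * y ^ℚ (s ∸ i) ≡ Σ (λ l → ℕtoℚ (r l) * (coef i * ℕtoℚ (σl s n l i) * y ^ℚ (s ∸ i)))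
      spread i = trans (comm (coef i) (ΣR i) (y ^ℚ (s ∸ i)))
                       (trans (*-distribˡ-Σ (coef i * y ^ℚ (s ∸ i)) (λ l → ℕtoℚ (r l) * ℕtoℚ (σl s n l i)))
                              (Σ-cong (λ l → shuffle (coef i) (y ^ℚ (s ∸ i)) (ℕtoℚ (r l)) (ℕtoℚ (σl s n l i)))))
        where
        comm : ∀ c R Y → c * R * Y ≡ c * Y * R
        comm = solve-∀ ℚ-ring
        shuffle : ∀ c Y r σ → c * Y * (r * σ) ≡ r * (c * σ * Y)
        shuffle = solve-∀ ℚ-ring

seidel-entry : ∀ x d (b : Bool) →
  x * d - (1ℚ - d - ℕtoℚ 2 * (if not b then 1ℚ else 0ℚ)) ≡ (x + 1ℚ) * d + 1ℚ - ℕtoℚ 2 * (if b then 1ℚ else 0ℚ)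
seidel-entry x d true  = rearrange x d
  where
  rearrange : ∀ x d → x * d - (1ℚ - d - ℕtoℚ 2 * 0ℚ) ≡ (x + 1ℚ) * d + 1ℚ - ℕtoℚ 2 * 1ℚ
  rearrange = solve-∀ ℚ-ring
seidel-entry x d false = rearrange x d
  where
  rearrange : ∀ x d → x * d - (1ℚ - d - ℕtoℚ 2 * 1ℚ) ≡ (x + 1ℚ) * d + 1ℚ - ℕtoℚ 2 * 0ℚ
  rearrange = solve-∀ ℚ-ring

theorem2p9 : (s : ℕ) (r n : Fin s → ℕ)
    → Injective _≡_ _≡_ n
    → (∀ i → 1 ≤ n i)
    → (∀ i → 1 ≤ r i)
    → (x : ℚ) → seidelCharPoly (K s r n) x ≡ theorem2p9RHS s r n x
theorem2p9 s r n _ n≥1 r≥1 x = begin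
  seidelCharPoly (K s r n) x
    ≡⟨ det-cong (λ u v → seidel-entry x (δ u v) (lookup labels u ≡ᵇ lookup labels v)) ⟩
  det (M 1ℚ labels)
    ≡⟨ det-partLabels 0 sizes 1ℚ ⟩
  Φ sizes + 1ℚ * Ψ sizes
    ≡⟨ det-multipart-factorised s r n n≥1 r≥1 ⟩
  (y ^ℚ Σℕ (λ i → r i ℕ.* (n i ∸ 1)) * Π (λ i → w (n i) ^ℚ (r i ∸ 1))) * (Π (w ∘ n) + Σ (λ l → ℕtoℚ (r l) * ℕtoℚ (n l) * Π-except l (w ∘ n)))
    ≡⟨ cong₂ (λ e q → (y ^ℚ e * Π (λ i → w (n i) ^ℚ (r i ∸ 1))) * q)
             (sym (vertexCount∸partCount r n n≥1)) (sym (Expansion.residualFactor≡ x s r n)) ⟩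
  theorem2p9RHS s r n x ∎
  where
  y : ℚ
  y = x + 1ℚ
  open LabelMatrix y
  sizes labels : List ℕ
  sizes = multipartSizes s r n
  labels = partLabels 0 sizes
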